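{- Let $q$ be a prime power and $n\ge 2$. If $E$ and $F$ are $\mathbb F_q$-subspaces of $\mathbb F_{q^n}$ with $\mathbb F_{q^n}=E\oplus F$, then \[ \sum_{0\ne u\in E}\frac 1{u^{q-1}}\ne 0\iff \sum_{0\ne v\in L_E(F)}\frac 1{v^{q-1}}\ne 0, \] where $L_E(X)=\prod_{u\in E}(X-u)$. In particular, for each $1\le k\le n-1$, $g_{q-1}$ is not $k$th order sum-free on $\mathbb F_{q^n}$ if and only if it is not $(n-k)$th order sum-free.
   Context: $L_E$ is an $\mathbb F_q$-linear map of $\mathbb F_{q^n}$ with kernel $E$. $g_{q-1}(x)=1/x^{q-1}$ for $x\ne0$, $g_{q-1}(0)=0$. A function $f:\mathbb F_{q^n}\to\mathbb F_{q^n}$ is $k$th order sum-free if $\sum_{x\in A}f(x)\ne0$ for every $k$-dimensional $\mathbb F_q$-affine subspace $A$ of $\mathbb F_{q^n}$. -}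

module Defs where

open import Level using (0ℓ)
open import Data.Nat as ℕ using (ℕ; zero; suc)
open import Data.Fin using (Fin; zero; suc)
open import Data.Product using (Σ; ∃; _×_; _,_)
open import Data.List using (List; foldr; filter)
open import Data.List.Membership.Propositional using (_∈_)
open import Data.List.Relation.Unary.Unique.Propositional using (Unique)
open import Data.List.Relation.Unary.Any using (Any; any?)
open import Function using (_∘_)
open import Function.Bundles using (_⇔_)
open import Relation.Nullary using (¬_; Dec; yes; no)
open import Relation.Nullary.Decidable using (_×-dec_; ¬?)
open import Relation.Unary using (Pred; Decidable)
open import Relation.Binary.PropositionalEquality using (_≡_; _≢_)
open import Algebra.Structures using (IsCommutativeRing)

record FiniteField : Set₁ where
  infixl 7 _*_
  infixl 6 _+_ _-_
  field
    Carrier  : Set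
    _+_ _*_  : Carrier → Carrier → Carrier
    -_       : Carrier → Carrier
    0# 1#    : Carrier
    _⁻¹      : Carrier → Carrier
    isCommutativeRing : IsCommutativeRing _≡_ _+_ _*_ -_ 0# 1#
    0≢1      : 0# ≢ 1#
    inverseʳ : ∀ x → x ≢ 0# → x * (x ⁻¹) ≡ 1#
    _≟_      : (x y : Carrier) → Dec (x ≡ y)
    elems    : List Carrier
    complete : ∀ x → x ∈ elems
    unique   : Unique elems

  _-_ : Carrier → Carrier → Carrier
  x - y = x + (- y)

  _^_ : Carrier → ℕ → Carrier
  x ^ zero  = 1#
  x ^ suc n = x * (x ^ n)

  card : ℕ
  card = Data.List.length elems

  sumL : List Carrier → (Carrier → Carrier) → Carrier
  sumL xs f = foldr (λ x acc → f x + acc) 0# xs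

  prodL : List Carrier → (Carrier → Carrier) → Carrier
  prodL xs f = foldr (λ x acc → f x * acc) 1# xs

  elemsOf : {P : Pred Carrier 0ℓ} → Decidable P → List Carrier
  elemsOf P? = filter P? elems

  module OverBase (q : ℕ) where

    -- the subfield F_q = { c | c^q = c }  (when card ≡ q^n)
    InFq : Carrier → Set
    InFq c = c ^ q ≡ c

    record Subspace : Set₁ where
      field
        mem     : Pred Carrier 0ℓ
        mem?    : Decidable mem
        zero∈   : mem 0#
        +-closed : ∀ {x y} → mem x → mem y → mem (x + y)
        ·-closed : ∀ {c x} → InFq c → mem x → mem (c * x)
    open Subspace public

    record DirectSum (E F : Subspace) : Set where
      field
        trivial∩ : ∀ x → mem E x → mem F x → x ≡ 0#
        spanning : ∀ x → ∃ λ e → ∃ λ f → mem E e × mem F f × x ≡ e + f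

    L : Subspace → Carrier → Carrier
    L E x = prodL (elemsOf (mem? E)) (λ u → x - u)

    InImage : Subspace → Subspace → Pred Carrier 0ℓ
    InImage E F v = Any (λ f → mem F f × L E f ≡ v) elems

    InImage? : (E F : Subspace) → Decidable (InImage E F)
    InImage? E F v = any? (λ f → mem? F f ×-dec (L E f ≟ v)) elems

    -- 1 / x^(q-1)  (for use on nonzero x)
    invPow : Carrier → Carrier
    invPow x = (x ^ (q ℕ.∸ 1)) ⁻¹

    sumInvPowNonzero : {S : Pred Carrier 0ℓ} → Decidable S → Carrier
    sumInvPowNonzero S? =
      sumL (filter (λ u → S? u ×-dec ¬? (u ≟ 0#)) elems) invPow

    g : Carrier → Carrier
    g x with x ≟ 0#
    ... | yes _ = 0#
    ... | no  _ = invPow x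

    lincomb : {k : ℕ} → (Fin k → Carrier) → (Fin k → Carrier) → Carrier
    lincomb {zero}  c v = 0#
    lincomb {suc k} c v = c zero * v zero + lincomb (c ∘ suc) (v ∘ suc)

    record AffineSubspace (k : ℕ) : Set₁ where
      field
        amem   : Pred Carrier 0ℓ
        amem?  : Decidable amem
        base   : Carrier
        basis  : Fin k → Carrier
        indep  : ∀ (c : Fin k → Carrier) → (∀ i → InFq (c i)) →
                 lincomb c basis ≡ 0# → ∀ i → c i ≡ 0#
        char   : ∀ x → amem x ⇔
                 (∃ λ (c : Fin k → Carrier) → (∀ i → InFq (c i)) × x ≡ base + lincomb c basis)

    SumFree : ℕ → (Carrier → Carrier) → Set₁
    SumFree k f = ∀ (A : AffineSubspace k) →
      sumL (elemsOf (AffineSubspace.amem? A)) f ≢ 0#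

{-# OPTIONS --safe #-}
-- For an 𝔽q-subspace W of K = 𝔽_{q^n} the subspace polynomial L_W(x) = ∏_{u ∈ W} (x - u) is 𝔽q-linear
-- and satisfies L_{W + 𝔽q a}(x) = L_W(x)^q - L_W(a)^(q-1) L_W(x).  Summing g(x) = x^-(q-1) over a coset
-- of 𝔽q gives ∑_{c ∈ 𝔽q} g(z + c) = g(z^q - z) for z ∉ 𝔽q, and by induction on W
-- ∑_{v ∈ W} g(x + v) = g(L_W(x) / L_W'(0)) ≠ 0 for x ∉ W.  Consequently, for W = T ⊕ E,
--   ∑_{v ∈ W} g(v) = ∑_{v ∈ E} g(v) + g(1 / L_E'(0)) ∑_{v ∈ L_E(T)} g(v).
-- The sum over all of K vanishes (scale by an element outside 𝔽q), so for K = F ⊕ E the sum over E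
-- vanishes iff the sum over L_E(F) does.  A k-dimensional affine subspace with zero sum must be a linear
-- subspace E, and writing K = T ⊕ E, the (n - k)-dimensional subspace L_E(T) has zero sum as well.
module Submission where

open import Defs

open import Level using (0ℓ)
open import Algebra.Bundles using (CommutativeRing; CommutativeMonoid)
open import Algebra.Core using (Op₁; Op₂)
open import Algebra.Structures using (IsCommutativeMonoid; IsCommutativeRing)
import Algebra.Properties.CommutativeSemigroup as CommutativeSemigroupProperties
import Algebra.Properties.CommutativeSemiring.Binomial as BinomialProperties
import Algebra.Properties.Monoid.Sum as SumProperties
import Algebra.Properties.Ring as RingProperties
import Algebra.Properties.Semiring.Exp as ExpProperties
import Algebra.Properties.Semiring.Mult as MultProperties
open import Algebra.Solver.Ring.AlmostCommutativeRing
  using (fromCommutativeRing; _-Raw-AlmostCommutative⟶_)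
open import Data.Empty using (⊥-elim)
open import Data.Fin as Fin using (Fin; toℕ)
import Data.Fin.Properties as Fin
open import Data.Integer as ℤ using (ℤ; -[1+_])
import Data.Integer.Properties as ℤ
open import Data.List
  using (List; []; _∷_; _++_; [_]; map; concatMap; filter; length; replicate; tabulate; lookup)
import Data.List.Properties as List
open import Data.List.Membership.DecPropositional using () renaming (_∈?_ to ∈-dec)
open import Data.List.Membership.Propositional using (_∈_; _∉_; find)
open import Data.List.Membership.Propositional.Properties
  using (∈-filter⁺; ∈-filter⁻; ∈-map⁺; ∈-map⁻; ∈-concat⁺′; ∈-concat⁻′)
open import Data.List.Membership.Propositional.Properties.WithK using (unique∧set⇒bag)
open import Data.List.Relation.Binary.BagAndSetEquality using (∼bag⇒↭)
open import Data.List.Relation.Binary.Disjoint.Propositional using (Disjoint)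
open import Data.List.Relation.Binary.Permutation.Propositional using (_↭_; refl; prep; swap; trans)
open import Data.List.Relation.Binary.Permutation.Propositional.Properties using (↭-length)
open import Data.List.Relation.Binary.Subset.Propositional using (_⊆_)
open import Data.List.Relation.Unary.All as All using (All; []; _∷_)
import Data.List.Relation.Unary.All.Properties as All
open import Data.List.Relation.Unary.AllPairs as AllPairs using (AllPairs; []; _∷_)
import Data.List.Relation.Unary.AllPairs.Properties as AllPairs
open import Data.List.Relation.Unary.Any as Any using (here; there; any?)
open import Data.List.Relation.Unary.Unique.Propositional using (Unique)
import Data.List.Relation.Unary.Unique.Propositional.Properties as Unique
open import Data.Maybe using (Maybe; just; nothing)
open import Data.Nat as ℕ using (ℕ; zero; suc; _≤_; _<_; s≤s; z≤n)
import Data.Nat.Properties as ℕ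
open import Data.Nat.Combinatorics using (_C_; nCk+nC[k+1]≡[n+1]C[k+1]; nC1≡n; nCn≡1)
open import Data.Nat.Divisibility using (_∣_; divides; ∣⇒≤)
open import Data.Nat.Primality using (Prime; euclidsLemma; prime⇒nonZero; prime⇒nonTrivial)
open import Data.Nat.Solver using (module +-*-Solver)
open import Data.Product using (∃; _×_; _,_; proj₁; proj₂)
open import Data.Sign as Sign using (Sign)
open import Data.Sum using (_⊎_; inj₁; inj₂)
open import Data.Unit using (⊤; tt)
import Data.Vec.Functional as VF
open import Function using (_∘_)
open import Function.Bundles using (_⇔_; mk⇔; Equivalence)
open import Relation.Binary.Definitions using (DecidableEquality)
open import Relation.Binary.PropositionalEquality
  using (_≡_; _≢_; refl; sym; cong; cong₂; subst; subst₂; module ≡-Reasoning)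
  renaming (trans to ≡-trans)
open import Relation.Nullary using (¬_; Dec; yes; no)
open import Relation.Nullary.Decidable using (¬?; _×-dec_)
open import Relation.Unary using (Pred; Decidable)

module FoldProperties {A : Set} {_∙_ : Op₂ A} {ε : A}
                      (isCommutativeMonoid : IsCommutativeMonoid _≡_ _∙_ ε) where

  open IsCommutativeMonoid isCommutativeMonoid using (assoc; identityˡ)

  commutativeMonoid : CommutativeMonoid 0ℓ 0ℓ
  commutativeMonoid = record { isCommutativeMonoid = isCommutativeMonoid }

  open CommutativeSemigroupProperties (CommutativeMonoid.commutativeSemigroup commutativeMonoid)
    using (interchange; x∙yz≈y∙xz)

  fold : {B : Set} → List B → (B → A) → A
  fold xs f = Data.List.foldr (λ x acc → f x ∙ acc) ε xs

  fold-++ : {B : Set} (xs ys : List B) (f : B → A) → fold (xs ++ ys) f ≡ fold xs f ∙ fold ys f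
  fold-++ []       ys f = sym (identityˡ _)
  fold-++ (x ∷ xs) ys f = ≡-trans (cong (f x ∙_) (fold-++ xs ys f)) (sym (assoc _ _ _))

  fold-map : {B C : Set} (h : C → B) (xs : List C) (f : B → A) → fold (map h xs) f ≡ fold xs (f ∘ h)
  fold-map h []       f = refl
  fold-map h (x ∷ xs) f = cong (f (h x) ∙_) (fold-map h xs f)

  fold-concatMap : {B C : Set} (h : C → List B) (xs : List C) (f : B → A) →
                   fold (concatMap h xs) f ≡ fold xs (λ x → fold (h x) f)
  fold-concatMap h []       f = refl
  fold-concatMap h (x ∷ xs) f =
    ≡-trans (fold-++ (h x) (concatMap h xs) f) (cong (fold (h x) f ∙_) (fold-concatMap h xs f))

  fold-cong : {B : Set} (xs : List B) {f g : B → A} → (∀ {x} → x ∈ xs → f x ≡ g x) → fold xs f ≡ fold xs g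
  fold-cong []       f≡g = refl
  fold-cong (x ∷ xs) f≡g = cong₂ _∙_ (f≡g (here refl)) (fold-cong xs (f≡g ∘ there))

  fold-ext : {B : Set} (xs : List B) {f g : B → A} → (∀ x → f x ≡ g x) → fold xs f ≡ fold xs g
  fold-ext xs f≡g = fold-cong xs (λ {x} _ → f≡g x)

  fold-ε : {B : Set} (xs : List B) → fold xs (λ _ → ε) ≡ ε
  fold-ε []       = refl
  fold-ε (x ∷ xs) = ≡-trans (cong (ε ∙_) (fold-ε xs)) (identityˡ ε)

  fold-distrib : {B : Set} (xs : List B) (f g : B → A) → fold xs (λ x → f x ∙ g x) ≡ fold xs f ∙ fold xs g
  fold-distrib []       f g = sym (identityˡ ε)
  fold-distrib (x ∷ xs) f g = ≡-trans (cong ((f x ∙ g x) ∙_) (fold-distrib xs f g)) (interchange _ _ _ _)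

  fold-↭ : {B : Set} (f : B → A) {xs ys : List B} → xs ↭ ys → fold xs f ≡ fold ys f
  fold-↭ f refl           = refl
  fold-↭ f (prep x p)     = cong (f x ∙_) (fold-↭ f p)
  fold-↭ f (swap x y p)   = ≡-trans (cong (λ t → f x ∙ (f y ∙ t)) (fold-↭ f p)) (x∙yz≈y∙xz _ _ _)
  fold-↭ f (trans p₁ p₂) = ≡-trans (fold-↭ f p₁) (fold-↭ f p₂)

module _ {A : Set} where

  ⊆∧⊇⇒↭ : {xs ys : List A} → Unique xs → Unique ys → xs ⊆ ys → ys ⊆ xs → xs ↭ ys
  ⊆∧⊇⇒↭ ux uy xs⊆ys ys⊆xs = ∼bag⇒↭ (unique∧set⇒bag ux uy (mk⇔ xs⊆ys ys⊆xs))

  unique-⊆⇒length≤ : DecidableEquality A → {xs ys : List A} → Unique xs → Unique ys → xs ⊆ ys →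
                     length xs ≤ length ys
  unique-⊆⇒length≤ _≟_ {xs} {ys} ux uy xs⊆ys =
    ℕ.≤-trans (ℕ.≤-reflexive (↭-length (⊆∧⊇⇒↭ ux (Unique.filter⁺ ∈xs? uy) into out)))
              (List.length-filter ∈xs? ys)
    where
    ∈xs? : Decidable (_∈ xs)
    ∈xs? x = ∈-dec _≟_ x xs
    into : xs ⊆ filter ∈xs? ys
    into x∈xs = ∈-filter⁺ ∈xs? (xs⊆ys x∈xs) x∈xs
    out : filter ∈xs? ys ⊆ xs
    out x∈ = proj₂ (∈-filter⁻ ∈xs? {xs = ys} x∈)

  length-filter+length-filter∁ : {P : Pred A 0ℓ} (P? : Decidable P) (xs : List A) →
                                 length xs ≡ length (filter P? xs) ℕ.+ length (filter (¬? ∘ P?) xs)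
  length-filter+length-filter∁ P? []       = refl
  length-filter+length-filter∁ P? (x ∷ xs) with P? x
  ... | yes _ = cong suc (length-filter+length-filter∁ P? xs)
  ... | no  _ = ≡-trans (cong suc (length-filter+length-filter∁ P? xs)) (sym (ℕ.+-suc _ _))

  map-bijection-↭ : (h h⁻¹ : A → A) → (∀ x → h⁻¹ (h x) ≡ x) → (∀ y → h (h⁻¹ y) ≡ y) →
                    {xs : List A} → Unique xs → (∀ {x} → x ∈ xs → h x ∈ xs) →
                    (∀ {x} → x ∈ xs → h⁻¹ x ∈ xs) → map h xs ↭ xs
  map-bijection-↭ h h⁻¹ h⁻¹∘h h∘h⁻¹ {xs} ux h-closed h⁻¹-closed =
    ⊆∧⊇⇒↭ (Unique.map⁺ h-injective ux) ux image⊆ ⊆image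
    where
    h-injective : ∀ {x y} → h x ≡ h y → x ≡ y
    h-injective {x} {y} hx≡hy = ≡-trans (sym (h⁻¹∘h x)) (≡-trans (cong h⁻¹ hx≡hy) (h⁻¹∘h y))
    image⊆ : map h xs ⊆ xs
    image⊆ y∈ with ∈-map⁻ h y∈
    ... | x , x∈xs , refl = h-closed x∈xs
    ⊆image : xs ⊆ map h xs
    ⊆image {y} y∈xs = subst (_∈ map h xs) (h∘h⁻¹ y) (∈-map⁺ h (h⁻¹-closed y∈xs))

module _ where
  open import Data.Nat.Base using (_+_; _*_)
  open ≡-Reasoning

  [k+1]*[n+1]C[k+1]≡[n+1]*nCk : ∀ n k → suc k * (suc n C suc k) ≡ suc n * (n C k)
  [k+1]*[n+1]C[k+1]≡[n+1]*nCk n       zero    =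
    ≡-trans (ℕ.*-identityˡ _) (≡-trans (nC1≡n (suc n)) (sym (ℕ.*-identityʳ (suc n))))
  [k+1]*[n+1]C[k+1]≡[n+1]*nCk zero    (suc k) = ℕ.*-zeroʳ (suc (suc k))
  [k+1]*[n+1]C[k+1]≡[n+1]*nCk (suc n) (suc k) = begin
    (2 + k) * ((2 + n) C (2 + k))         ≡⟨ cong ((2 + k) *_) (sym (nCk+nC[k+1]≡[n+1]C[k+1] (suc n) (suc k))) ⟩
    (2 + k) * (c₁ + c₂)                   ≡⟨ ℕ.*-distribˡ-+ (2 + k) c₁ c₂ ⟩
    c₁ + (1 + k) * c₁ + (2 + k) * c₂      ≡⟨ cong₂ (λ a b → c₁ + a + b) ([k+1]*[n+1]C[k+1]≡[n+1]*nCk n k)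
                                                                        ([k+1]*[n+1]C[k+1]≡[n+1]*nCk n (suc k)) ⟩
    c₁ + (1 + n) * (n C k) + (1 + n) * (n C (1 + k))   ≡⟨ ℕ.+-assoc c₁ _ _ ⟩
    c₁ + ((1 + n) * (n C k) + (1 + n) * (n C (1 + k))) ≡⟨ cong (c₁ +_) (sym (ℕ.*-distribˡ-+ (1 + n) (n C k) _)) ⟩
    c₁ + (1 + n) * (n C k + n C (1 + k))  ≡⟨ cong (λ t → c₁ + (1 + n) * t) (nCk+nC[k+1]≡[n+1]C[k+1] n k) ⟩
    (2 + n) * c₁                          ∎
    where
    c₁ = (1 + n) C (1 + k)
    c₂ = (1 + n) C (2 + k)

  [1+d][1+dG]≡1+d[1+[1+d]G] : ∀ d G → suc d * suc (d * G) ≡ suc (d * suc (suc d * G))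
  [1+d][1+dG]≡1+d[1+[1+d]G] = solve 2 (λ d G → (con 1 :+ d) :* (con 1 :+ d :* G) := con 1 :+ d :* (con 1 :+ (con 1 :+ d) :* G)) refl
    where open +-*-Solver

p∣pCk : ∀ {p k} → Prime p → 0 < k → k < p → p ∣ p C k
p∣pCk {suc n} {suc k} p-prime _ k<p
  with euclidsLemma (suc k) (suc n C suc k) p-prime
         (divides (n C k) (≡-trans ([k+1]*[n+1]C[k+1]≡[n+1]*nCk n k) (ℕ.*-comm (suc n) (n C k))))
... | inj₂ p∣pCk = p∣pCk
... | inj₁ p∣k   = ⊥-elim (ℕ.<⇒≱ k<p (∣⇒≤ p∣k))

module IntegerRingSolver {A : Set} {plus times : Op₂ A} {negate : Op₁ A} {0ᴬ 1ᴬ : A}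
                         (isCommutativeRing : IsCommutativeRing _≡_ plus times negate 0ᴬ 1ᴬ) where

  open ≡-Reasoning

  commutativeRing : CommutativeRing 0ℓ 0ℓ
  commutativeRing = record { isCommutativeRing = isCommutativeRing }

  open CommutativeRing commutativeRing
    using ( Carrier; _+_; _*_; -_; _-_; 0#; 1#
          ; +-assoc; +-comm; +-identityˡ; +-identityʳ; -‿inverseʳ; zeroˡ; *-identityˡ; distribʳ )
  open RingProperties (CommutativeRing.ring commutativeRing)
    using (-‿involutive; -‿distribˡ-*; -‿distribʳ-*; -0#≈0#; -‿+-comm)
  open CommutativeSemigroupProperties (CommutativeRing.+-commutativeSemigroup commutativeRing)
    using () renaming (interchange to +-interchange)

  -- The clause for 1 makes ⟦ 1 ⟧ℕ reduce to 1#, so that the solver constants 𝟘 and 𝟙 below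
  -- denote 0# and 1# on the nose.
  ⟦_⟧ℕ : ℕ → Carrier
  ⟦ zero ⟧ℕ        = 0#
  ⟦ suc zero ⟧ℕ    = 1#
  ⟦ suc (suc n) ⟧ℕ = 1# + ⟦ suc n ⟧ℕ

  ⟦suc⟧ℕ : ∀ n → ⟦ suc n ⟧ℕ ≡ 1# + ⟦ n ⟧ℕ
  ⟦suc⟧ℕ zero    = sym (+-identityʳ 1#)
  ⟦suc⟧ℕ (suc n) = refl

  ⟦+⟧ℕ : ∀ m n → ⟦ m ℕ.+ n ⟧ℕ ≡ ⟦ m ⟧ℕ + ⟦ n ⟧ℕ
  ⟦+⟧ℕ zero    n = sym (+-identityˡ _)
  ⟦+⟧ℕ (suc m) n = begin
    ⟦ suc (m ℕ.+ n) ⟧ℕ      ≡⟨ ⟦suc⟧ℕ (m ℕ.+ n) ⟩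
    1# + ⟦ m ℕ.+ n ⟧ℕ       ≡⟨ cong (1# +_) (⟦+⟧ℕ m n) ⟩
    1# + (⟦ m ⟧ℕ + ⟦ n ⟧ℕ)  ≡⟨ sym (+-assoc _ _ _) ⟩
    (1# + ⟦ m ⟧ℕ) + ⟦ n ⟧ℕ  ≡⟨ cong (_+ ⟦ n ⟧ℕ) (sym (⟦suc⟧ℕ m)) ⟩
    ⟦ suc m ⟧ℕ + ⟦ n ⟧ℕ     ∎

  ⟦*⟧ℕ : ∀ m n → ⟦ m ℕ.* n ⟧ℕ ≡ ⟦ m ⟧ℕ * ⟦ n ⟧ℕ
  ⟦*⟧ℕ zero    n = sym (zeroˡ _)
  ⟦*⟧ℕ (suc m) n = begin
    ⟦ n ℕ.+ m ℕ.* n ⟧ℕ            ≡⟨ ⟦+⟧ℕ n (m ℕ.* n) ⟩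
    ⟦ n ⟧ℕ + ⟦ m ℕ.* n ⟧ℕ         ≡⟨ cong₂ _+_ (sym (*-identityˡ _)) (⟦*⟧ℕ m n) ⟩
    1# * ⟦ n ⟧ℕ + ⟦ m ⟧ℕ * ⟦ n ⟧ℕ ≡⟨ sym (distribʳ _ _ _) ⟩
    (1# + ⟦ m ⟧ℕ) * ⟦ n ⟧ℕ        ≡⟨ cong (_* ⟦ n ⟧ℕ) (sym (⟦suc⟧ℕ m)) ⟩
    ⟦ suc m ⟧ℕ * ⟦ n ⟧ℕ           ∎

  ⟦_⟧ℤ : ℤ → Carrier
  ⟦ ℤ.+ n ⟧ℤ    = ⟦ n ⟧ℕ
  ⟦ -[1+ n ] ⟧ℤ = - ⟦ suc n ⟧ℕ

  ⟦⊖⟧ℤ : ∀ m n → ⟦ m ℤ.⊖ n ⟧ℤ ≡ ⟦ m ⟧ℕ - ⟦ n ⟧ℕ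
  ⟦⊖⟧ℤ zero    zero    = sym (-‿inverseʳ 0#)
  ⟦⊖⟧ℤ (suc m) zero    = sym (≡-trans (cong (⟦ suc m ⟧ℕ +_) -0#≈0#) (+-identityʳ _))
  ⟦⊖⟧ℤ zero    (suc n) = sym (+-identityˡ _)
  ⟦⊖⟧ℤ (suc m) (suc n) = begin
    ⟦ suc m ℤ.⊖ suc n ⟧ℤ
      ≡⟨ cong ⟦_⟧ℤ (ℤ.[1+m]⊖[1+n]≡m⊖n m n) ⟩
    ⟦ m ℤ.⊖ n ⟧ℤ
      ≡⟨ ⟦⊖⟧ℤ m n ⟩
    ⟦ m ⟧ℕ - ⟦ n ⟧ℕ
      ≡⟨ sym (+-identityˡ _) ⟩
    0# + (⟦ m ⟧ℕ - ⟦ n ⟧ℕ)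
      ≡⟨ cong (_+ (⟦ m ⟧ℕ - ⟦ n ⟧ℕ)) (sym (-‿inverseʳ 1#)) ⟩
    (1# - 1#) + (⟦ m ⟧ℕ - ⟦ n ⟧ℕ)
      ≡⟨ +-interchange 1# (- 1#) ⟦ m ⟧ℕ (- ⟦ n ⟧ℕ) ⟩
    (1# + ⟦ m ⟧ℕ) + (- 1# + - ⟦ n ⟧ℕ)
      ≡⟨ cong₂ _+_ (sym (⟦suc⟧ℕ m)) (≡-trans (-‿+-comm 1# _) (cong -_ (sym (⟦suc⟧ℕ n)))) ⟩
    ⟦ suc m ⟧ℕ - ⟦ suc n ⟧ℕ ∎

  ⟦+⟧ℤ : ∀ i j → ⟦ i ℤ.+ j ⟧ℤ ≡ ⟦ i ⟧ℤ + ⟦ j ⟧ℤ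
  ⟦+⟧ℤ (ℤ.+ m)  (ℤ.+ n)  = ⟦+⟧ℕ m n
  ⟦+⟧ℤ (ℤ.+ m)  -[1+ n ] = ⟦⊖⟧ℤ m (suc n)
  ⟦+⟧ℤ -[1+ m ] (ℤ.+ n)  = ≡-trans (⟦⊖⟧ℤ n (suc m)) (+-comm _ _)
  ⟦+⟧ℤ -[1+ m ] -[1+ n ] = begin
    - ⟦ suc (suc (m ℕ.+ n)) ⟧ℕ    ≡⟨ cong (λ k → - ⟦ k ⟧ℕ) (sym (ℕ.+-suc (suc m) n)) ⟩
    - ⟦ suc m ℕ.+ suc n ⟧ℕ        ≡⟨ cong -_ (⟦+⟧ℕ (suc m) (suc n)) ⟩
    - (⟦ suc m ⟧ℕ + ⟦ suc n ⟧ℕ)   ≡⟨ sym (-‿+-comm _ _) ⟩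
    - ⟦ suc m ⟧ℕ + - ⟦ suc n ⟧ℕ   ∎

  signed : Sign → Carrier → Carrier
  signed Sign.+ x = x
  signed Sign.- x = - x

  ⟦◃⟧ℤ : ∀ s n → ⟦ s ℤ.◃ n ⟧ℤ ≡ signed s ⟦ n ⟧ℕ
  ⟦◃⟧ℤ Sign.+ zero    = refl
  ⟦◃⟧ℤ Sign.- zero    = sym -0#≈0#
  ⟦◃⟧ℤ Sign.+ (suc n) = refl
  ⟦◃⟧ℤ Sign.- (suc n) = refl

  ⟦⟧ℤ-signAbs : ∀ i → ⟦ i ⟧ℤ ≡ signed (ℤ.sign i) ⟦ ℤ.∣ i ∣ ⟧ℕ
  ⟦⟧ℤ-signAbs (ℤ.+ n)  = refl
  ⟦⟧ℤ-signAbs -[1+ n ] = refl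

  signed-* : ∀ s t x y → signed s x * signed t y ≡ signed (s Sign.* t) (x * y)
  signed-* Sign.+ Sign.+ x y = refl
  signed-* Sign.+ Sign.- x y = sym (-‿distribʳ-* x y)
  signed-* Sign.- Sign.+ x y = sym (-‿distribˡ-* x y)
  signed-* Sign.- Sign.- x y =
    ≡-trans (sym (-‿distribˡ-* x (- y))) (≡-trans (cong -_ (sym (-‿distribʳ-* x y))) (-‿involutive _))

  ⟦*⟧ℤ : ∀ i j → ⟦ i ℤ.* j ⟧ℤ ≡ ⟦ i ⟧ℤ * ⟦ j ⟧ℤ
  ⟦*⟧ℤ i j = begin
    ⟦ i ℤ.* j ⟧ℤ                      ≡⟨ ⟦◃⟧ℤ (s Sign.* t) (∣i∣ ℕ.* ∣j∣) ⟩
    signed (s Sign.* t) ⟦ ∣i∣ ℕ.* ∣j∣ ⟧ℕ   ≡⟨ cong (signed (s Sign.* t)) (⟦*⟧ℕ ∣i∣ ∣j∣) ⟩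
    signed (s Sign.* t) (⟦ ∣i∣ ⟧ℕ * ⟦ ∣j∣ ⟧ℕ) ≡⟨ sym (signed-* s t _ _) ⟩
    signed s ⟦ ∣i∣ ⟧ℕ * signed t ⟦ ∣j∣ ⟧ℕ  ≡⟨ sym (cong₂ _*_ (⟦⟧ℤ-signAbs i) (⟦⟧ℤ-signAbs j)) ⟩
    ⟦ i ⟧ℤ * ⟦ j ⟧ℤ                   ∎
    where
    s = ℤ.sign i
    t = ℤ.sign j
    ∣i∣ = ℤ.∣ i ∣
    ∣j∣ = ℤ.∣ j ∣

  ⟦-⟧ℤ : ∀ i → ⟦ ℤ.- i ⟧ℤ ≡ - ⟦ i ⟧ℤ
  ⟦-⟧ℤ (ℤ.+ zero)  = sym -0#≈0#
  ⟦-⟧ℤ (ℤ.+ suc n) = refl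
  ⟦-⟧ℤ -[1+ n ]    = sym (-‿involutive _)

  ℤ-morphism : ℤ.+-*-rawRing -Raw-AlmostCommutative⟶ fromCommutativeRing commutativeRing
  ℤ-morphism = record
    { ⟦_⟧ = ⟦_⟧ℤ ; +-homo = ⟦+⟧ℤ ; *-homo = ⟦*⟧ℤ ; -‿homo = ⟦-⟧ℤ ; 0-homo = refl ; 1-homo = refl }

  ⟦⟧ℤ-weaklyDecidable : ∀ i j → Maybe (⟦ i ⟧ℤ ≡ ⟦ j ⟧ℤ)
  ⟦⟧ℤ-weaklyDecidable i j with i ℤ.≟ j
  ... | yes i≡j = just (cong ⟦_⟧ℤ i≡j)
  ... | no  _   = nothing

  open import Algebra.Solver.Ring ℤ.+-*-rawRing (fromCommutativeRing commutativeRing)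
                                  ℤ-morphism ⟦⟧ℤ-weaklyDecidable public
    using (Polynomial; solve; _:=_; _:+_; _:*_; _:-_; :-_; con)

  𝟘 𝟙 : ∀ {k} → Polynomial k
  𝟘 = con (ℤ.+ 0)
  𝟙 = con (ℤ.+ 1)

module FieldProperties (K : FiniteField) where

  open FiniteField K public
  open ≡-Reasoning

  commutativeRing : CommutativeRing 0ℓ 0ℓ
  commutativeRing = record { isCommutativeRing = isCommutativeRing }

  open CommutativeRing commutativeRing public
    using ( +-assoc; +-comm; +-identityˡ; +-identityʳ; -‿inverseˡ; -‿inverseʳ
          ; *-assoc; *-comm; *-identityˡ; *-identityʳ; distribˡ; distribʳ; zeroˡ; zeroʳ
          ; +-isCommutativeMonoid; *-isCommutativeMonoid )
  open RingProperties (CommutativeRing.ring commutativeRing) public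
    using (-‿involutive; -‿distribˡ-*; -1*x≈-x; +-inverseʳ-unique; -0#≈0#; +-cancelˡ)
  open IntegerRingSolver isCommutativeRing public
    using (⟦_⟧ℕ; ⟦suc⟧ℕ; ⟦*⟧ℕ; solve; _:=_; _:+_; _:*_; _:-_; :-_; 𝟘; 𝟙)

  1≢0 : 1# ≢ 0#
  1≢0 = 0≢1 ∘ sym

  -1≢0 : - 1# ≢ 0#
  -1≢0 -1≡0 = 1≢0 (≡-trans (sym (-‿involutive 1#)) (≡-trans (cong -_ -1≡0) -0#≈0#))

  inverseˡ : ∀ x → x ≢ 0# → x ⁻¹ * x ≡ 1#
  inverseˡ x x≢0 = ≡-trans (*-comm _ _) (inverseʳ x x≢0)

  x-y≡0⇒x≡y : ∀ {x y} → x - y ≡ 0# → x ≡ y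
  x-y≡0⇒x≡y {x} {y} x-y≡0 = begin
    x              ≡⟨ solve 2 (λ x y → x := (x :- y) :+ y) refl x y ⟩
    (x - y) + y    ≡⟨ cong (_+ y) x-y≡0 ⟩
    0# + y         ≡⟨ +-identityˡ y ⟩
    y              ∎

  x*y≡0⇒x≡0⊎y≡0 : ∀ x y → x * y ≡ 0# → x ≡ 0# ⊎ y ≡ 0#
  x*y≡0⇒x≡0⊎y≡0 x y xy≡0 with x ≟ 0#
  ... | yes x≡0 = inj₁ x≡0
  ... | no  x≢0 = inj₂ (begin
    y                ≡⟨ sym (*-identityˡ y) ⟩
    1# * y           ≡⟨ cong (_* y) (sym (inverseˡ x x≢0)) ⟩
    (x ⁻¹ * x) * y   ≡⟨ *-assoc _ _ _ ⟩
    x ⁻¹ * (x * y)   ≡⟨ cong (x ⁻¹ *_) xy≡0 ⟩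
    x ⁻¹ * 0#        ≡⟨ zeroʳ _ ⟩
    0#               ∎)

  *-≢0 : ∀ {x y} → x ≢ 0# → y ≢ 0# → x * y ≢ 0#
  *-≢0 {x} {y} x≢0 y≢0 xy≡0 with x*y≡0⇒x≡0⊎y≡0 x y xy≡0
  ... | inj₁ x≡0 = x≢0 x≡0
  ... | inj₂ y≡0 = y≢0 y≡0

  *-cancelˡ : ∀ x {y z} → x ≢ 0# → x * y ≡ x * z → y ≡ z
  *-cancelˡ x {y} {z} x≢0 xy≡xz = x-y≡0⇒x≡y (⊎-elim-≢ (x*y≡0⇒x≡0⊎y≡0 x (y - z) x[y-z]≡0))
    where
    x[y-z]≡0 : x * (y - z) ≡ 0#
    x[y-z]≡0 = begin
      x * (y - z)        ≡⟨ solve 3 (λ x y z → x :* (y :- z) := x :* y :- x :* z) refl x y z ⟩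
      x * y - x * z      ≡⟨ cong (_- x * z) xy≡xz ⟩
      x * z - x * z      ≡⟨ -‿inverseʳ _ ⟩
      0#                 ∎
    ⊎-elim-≢ : x ≡ 0# ⊎ y - z ≡ 0# → y - z ≡ 0#
    ⊎-elim-≢ (inj₁ x≡0)   = ⊥-elim (x≢0 x≡0)
    ⊎-elim-≢ (inj₂ y-z≡0) = y-z≡0

  *-fixed⇒≡0 : ∀ {c s} → c ≢ 1# → c * s ≡ s → s ≡ 0#
  *-fixed⇒≡0 {c} {s} c≢1 cs≡s with x*y≡0⇒x≡0⊎y≡0 (c - 1#) s [c-1]s≡0
    where
    [c-1]s≡0 : (c - 1#) * s ≡ 0#
    [c-1]s≡0 = begin
      (c - 1#) * s   ≡⟨ solve 2 (λ c s → (c :- 𝟙) :* s := c :* s :- s) refl c s ⟩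
      c * s - s      ≡⟨ cong (_- s) cs≡s ⟩
      s - s          ≡⟨ -‿inverseʳ s ⟩
      0#             ∎
  ... | inj₁ c-1≡0 = ⊥-elim (c≢1 (x-y≡0⇒x≡y c-1≡0))
  ... | inj₂ s≡0   = s≡0

  ⁻¹-≢0 : ∀ {x} → x ≢ 0# → x ⁻¹ ≢ 0#
  ⁻¹-≢0 {x} x≢0 x⁻¹≡0 = 0≢1 (≡-trans (sym (zeroʳ x)) (≡-trans (cong (x *_) (sym x⁻¹≡0)) (inverseʳ x x≢0)))

  inverseʳ-unique : ∀ x y → x * y ≡ 1# → y ≡ x ⁻¹
  inverseʳ-unique x y xy≡1 = *-cancelˡ x x≢0 (≡-trans xy≡1 (sym (inverseʳ x x≢0)))
    where
    x≢0 : x ≢ 0#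
    x≢0 x≡0 = 0≢1 (≡-trans (sym (zeroˡ y)) (≡-trans (cong (_* y) (sym x≡0)) xy≡1))

  1⁻¹≡1 : 1# ⁻¹ ≡ 1#
  1⁻¹≡1 = sym (inverseʳ-unique 1# 1# (*-identityˡ 1#))

  ⁻¹-distrib-* : ∀ {x y} → x ≢ 0# → y ≢ 0# → (x * y) ⁻¹ ≡ x ⁻¹ * y ⁻¹
  ⁻¹-distrib-* {x} {y} x≢0 y≢0 = sym (inverseʳ-unique (x * y) (x ⁻¹ * y ⁻¹) (begin
    (x * y) * (x ⁻¹ * y ⁻¹)
      ≡⟨ solve 4 (λ x y a b → (x :* y) :* (a :* b) := (x :* a) :* (y :* b)) refl x y (x ⁻¹) (y ⁻¹) ⟩
    (x * x ⁻¹) * (y * y ⁻¹)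
      ≡⟨ cong₂ _*_ (inverseʳ x x≢0) (inverseʳ y y≢0) ⟩
    1# * 1#
      ≡⟨ *-identityˡ 1# ⟩
    1# ∎))

  x⁻¹≡1⇒x≡1 : ∀ {x} → x ≢ 0# → x ⁻¹ ≡ 1# → x ≡ 1#
  x⁻¹≡1⇒x≡1 {x} x≢0 x⁻¹≡1 =
    ≡-trans (inverseʳ-unique (x ⁻¹) x (inverseˡ x x≢0)) (≡-trans (cong _⁻¹ x⁻¹≡1) 1⁻¹≡1)

  x*y⁻¹*y≡x : ∀ x {y} → y ≢ 0# → (x * y ⁻¹) * y ≡ x
  x*y⁻¹*y≡x x {y} y≢0 = ≡-trans (*-assoc _ _ _) (≡-trans (cong (x *_) (inverseˡ y y≢0)) (*-identityʳ x))

  ^-distribˡ-+-* : ∀ x a b → x ^ (a ℕ.+ b) ≡ x ^ a * x ^ b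
  ^-distribˡ-+-* x zero    b = sym (*-identityˡ _)
  ^-distribˡ-+-* x (suc a) b = ≡-trans (cong (x *_) (^-distribˡ-+-* x a b)) (sym (*-assoc _ _ _))

  ^-*-assoc : ∀ x a b → (x ^ a) ^ b ≡ x ^ (a ℕ.* b)
  ^-*-assoc x a zero    = cong (x ^_) (sym (ℕ.*-zeroʳ a))
  ^-*-assoc x a (suc b) = begin
    x ^ a * (x ^ a) ^ b        ≡⟨ cong (x ^ a *_) (^-*-assoc x a b) ⟩
    x ^ a * x ^ (a ℕ.* b)      ≡⟨ sym (^-distribˡ-+-* x a (a ℕ.* b)) ⟩
    x ^ (a ℕ.+ a ℕ.* b)        ≡⟨ cong (x ^_) (sym (ℕ.*-suc a b)) ⟩
    x ^ (a ℕ.* suc b)          ∎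

  ^-distribʳ-* : ∀ x y a → (x * y) ^ a ≡ x ^ a * y ^ a
  ^-distribʳ-* x y zero    = sym (*-identityˡ 1#)
  ^-distribʳ-* x y (suc a) = ≡-trans (cong ((x * y) *_) (^-distribʳ-* x y a))
    (solve 4 (λ x y a b → (x :* y) :* (a :* b) := (x :* a) :* (y :* b)) refl x y (x ^ a) (y ^ a))

  1^n≡1 : ∀ n → 1# ^ n ≡ 1#
  1^n≡1 zero    = refl
  1^n≡1 (suc n) = ≡-trans (*-identityˡ _) (1^n≡1 n)

  0^n≡0 : ∀ {n} → 1 ≤ n → 0# ^ n ≡ 0#
  0^n≡0 (s≤s _) = zeroˡ _

  ^-≢0 : ∀ {x} n → x ≢ 0# → x ^ n ≢ 0#
  ^-≢0 zero    x≢0 = 1≢0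
  ^-≢0 (suc n) x≢0 = *-≢0 x≢0 (^-≢0 n x≢0)

  x^n≡0⇒x≡0 : ∀ {x} n → x ^ n ≡ 0# → x ≡ 0#
  x^n≡0⇒x≡0 {x} n xⁿ≡0 with x ≟ 0#
  ... | yes x≡0 = x≡0
  ... | no  x≢0 = ⊥-elim (^-≢0 n x≢0 xⁿ≡0)

  ⁻¹-^ : ∀ {x} n → x ≢ 0# → (x ^ n) ⁻¹ ≡ (x ⁻¹) ^ n
  ⁻¹-^ {x} n x≢0 = sym (inverseʳ-unique (x ^ n) ((x ⁻¹) ^ n)
    (≡-trans (sym (^-distribʳ-* x (x ⁻¹) n)) (≡-trans (cong (_^ n) (inverseʳ x x≢0)) (1^n≡1 n))))

  module ∑ = FoldProperties +-isCommutativeMonoid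
  module ∏ = FoldProperties *-isCommutativeMonoid

  sum-const : ∀ xs c → sumL xs (λ _ → c) ≡ ⟦ length xs ⟧ℕ * c
  sum-const []       c = sym (zeroˡ c)
  sum-const (x ∷ xs) c = begin
    c + sumL xs (λ _ → c)           ≡⟨ cong₂ _+_ (sym (*-identityˡ c)) (sum-const xs c) ⟩
    1# * c + ⟦ length xs ⟧ℕ * c     ≡⟨ sym (distribʳ c 1# _) ⟩
    (1# + ⟦ length xs ⟧ℕ) * c       ≡⟨ cong (_* c) (sym (⟦suc⟧ℕ (length xs))) ⟩
    ⟦ suc (length xs) ⟧ℕ * c        ∎

  prod-const : ∀ xs c → prodL xs (λ _ → c) ≡ c ^ length xs
  prod-const []       c = refl
  prod-const (x ∷ xs) c = cong (c *_) (prod-const xs c)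

  sum-distribˡ : ∀ xs c f → sumL xs (λ x → c * f x) ≡ c * sumL xs f
  sum-distribˡ []       c f = sym (zeroʳ c)
  sum-distribˡ (x ∷ xs) c f = ≡-trans (cong (c * f x +_) (sum-distribˡ xs c f)) (sym (distribˡ c _ _))

  sum-distribʳ : ∀ xs c f → sumL xs (λ x → f x * c) ≡ sumL xs f * c
  sum-distribʳ xs c f =
    ≡-trans (∑.fold-ext xs (λ x → *-comm (f x) c)) (≡-trans (sum-distribˡ xs c f) (*-comm c _))

  prod≡0 : ∀ xs f {x} → x ∈ xs → f x ≡ 0# → prodL xs f ≡ 0#
  prod≡0 (y ∷ xs) f (here refl) fx≡0 = ≡-trans (cong (_* prodL xs f) fx≡0) (zeroˡ _)
  prod≡0 (y ∷ xs) f (there x∈) fx≡0 = ≡-trans (cong (f y *_) (prod≡0 xs f x∈ fx≡0)) (zeroʳ _)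

  prod-≢0 : ∀ xs f → (∀ {x} → x ∈ xs → f x ≢ 0#) → prodL xs f ≢ 0#
  prod-≢0 []       f f≢0 = 1≢0
  prod-≢0 (x ∷ xs) f f≢0 = *-≢0 (f≢0 (here refl)) (prod-≢0 xs f (f≢0 ∘ there))

  prod≡0⇒∃f≡0 : ∀ xs f → prodL xs f ≡ 0# → ∃ λ x → x ∈ xs × f x ≡ 0#
  prod≡0⇒∃f≡0 []       f 1≡0 = ⊥-elim (1≢0 1≡0)
  prod≡0⇒∃f≡0 (x ∷ xs) f ∏≡0 with x*y≡0⇒x≡0⊎y≡0 (f x) (prodL xs f) ∏≡0
  ... | inj₁ fx≡0 = x , here refl , fx≡0
  ... | inj₂ ∏≡0′ with prod≡0⇒∃f≡0 xs f ∏≡0′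
  ...   | y , y∈ , fy≡0 = y , there y∈ , fy≡0

  ⟦^⟧ℕ : ∀ a b → ⟦ a ℕ.^ b ⟧ℕ ≡ ⟦ a ⟧ℕ ^ b
  ⟦^⟧ℕ a zero    = refl
  ⟦^⟧ℕ a (suc b) = ≡-trans (⟦*⟧ℕ a (a ℕ.^ b)) (cong (⟦ a ⟧ℕ *_) (⟦^⟧ℕ a b))

  elemsOf-↭ : {P : Pred Carrier 0ℓ} (P? : Decidable P) {xs : List Carrier} → Unique xs →
              (∀ {x} → P x → x ∈ xs) → (∀ {x} → x ∈ xs → P x) → elemsOf P? ↭ xs
  elemsOf-↭ P? ux P⊆xs xs⊆P = ⊆∧⊇⇒↭ (Unique.filter⁺ P? unique) ux
    (λ x∈ → P⊆xs (proj₂ (∈-filter⁻ P? {xs = elems} x∈)))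
    (λ x∈ → ∈-filter⁺ P? (complete _) (xs⊆P x∈))

  elems-↭ : {xs : List Carrier} → Unique xs → (∀ x → x ∈ xs) → elems ↭ xs
  elems-↭ ux all∈ = ⊆∧⊇⇒↭ unique ux (λ {x} _ → all∈ x) (λ _ → complete _)

  map-*-↭ : ∀ {a xs} → a ≢ 0# → Unique xs → (∀ {x} → x ∈ xs → a * x ∈ xs) →
            (∀ {x} → x ∈ xs → a ⁻¹ * x ∈ xs) → map (a *_) xs ↭ xs
  map-*-↭ {a} a≢0 = map-bijection-↭ (a *_) (a ⁻¹ *_) (cancel (inverseˡ a a≢0)) (cancel (inverseʳ a a≢0))
    where
    cancel : ∀ {b c} → b * c ≡ 1# → ∀ x → b * (c * x) ≡ x
    cancel {b} {c} bc≡1 x = ≡-trans (sym (*-assoc b c x)) (≡-trans (cong (_* x) bc≡1) (*-identityˡ x))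

  -- Translation by 1 permutes K, so adding card copies of 1 to ∑ x leaves it unchanged.
  card·1≡0 : ⟦ card ⟧ℕ ≡ 0#
  card·1≡0 = +-cancelˡ (sumL elems (λ x → x)) _ _ (begin
    sumL elems (λ x → x) + ⟦ card ⟧ℕ
      ≡⟨ cong (sumL elems (λ x → x) +_) (sym (≡-trans (sum-const elems 1#) (*-identityʳ _))) ⟩
    sumL elems (λ x → x) + sumL elems (λ _ → 1#)
      ≡⟨ sym (∑.fold-distrib elems (λ x → x) (λ _ → 1#)) ⟩
    sumL elems (λ x → x + 1#)
      ≡⟨ sym (∑.fold-map (_+ 1#) elems (λ x → x)) ⟩
    sumL (map (_+ 1#) elems) (λ x → x)
      ≡⟨ ∑.fold-↭ (λ x → x) (map-bijection-↭ (_+ 1#) (_- 1#) x+1-1 x-1+1 unique all∈ all∈) ⟩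
    sumL elems (λ x → x)
      ≡⟨ sym (+-identityʳ _) ⟩
    sumL elems (λ x → x) + 0# ∎)
    where
    x+1-1 : ∀ x → (x + 1#) - 1# ≡ x
    x+1-1 = solve 1 (λ x → (x :+ 𝟙) :- 𝟙 := x) refl
    x-1+1 : ∀ x → (x - 1#) + 1# ≡ x
    x-1+1 = solve 1 (λ x → (x :- 𝟙) :+ 𝟙 := x) refl
    all∈ : ∀ {x y} → x ∈ elems → y ∈ elems
    all∈ _ = complete _

  nonzero? : Decidable (_≢ 0#)
  nonzero? x = ¬? (x ≟ 0#)

  nonzeros : List Carrier
  nonzeros = filter nonzero? elems

  nonzeros-unique : Unique nonzeros
  nonzeros-unique = Unique.filter⁺ nonzero? unique

  ∈nonzeros⁺ : ∀ {x} → x ≢ 0# → x ∈ nonzeros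
  ∈nonzeros⁺ x≢0 = ∈-filter⁺ nonzero? (complete _) x≢0

  ∈nonzeros⁻ : ∀ {x} → x ∈ nonzeros → x ≢ 0#
  ∈nonzeros⁻ x∈ = proj₂ (∈-filter⁻ nonzero? {xs = elems} x∈)

  card≡1+length-nonzeros : card ≡ suc (length nonzeros)
  card≡1+length-nonzeros = ≡-trans (length-filter+length-filter∁ (_≟ 0#) elems)
    (cong (ℕ._+ length nonzeros) (↭-length zeros↭[0]))
    where
    zeros↭[0] : elemsOf (_≟ 0#) ↭ [ 0# ]
    zeros↭[0] = elemsOf-↭ (_≟ 0#) ([] ∷ []) (λ { refl → here refl }) (λ { (here refl) → refl })

  x^length-nonzeros≡1 : ∀ a → a ≢ 0# → a ^ length nonzeros ≡ 1#
  x^length-nonzeros≡1 a a≢0 = *-cancelˡ P (prod-≢0 nonzeros (λ x → x) ∈nonzeros⁻) (begin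
    P * a ^ length nonzeros                    ≡⟨ *-comm _ _ ⟩
    a ^ length nonzeros * P                    ≡⟨ cong (_* P) (sym (prod-const nonzeros a)) ⟩
    prodL nonzeros (λ _ → a) * P               ≡⟨ sym (∏.fold-distrib nonzeros (λ _ → a) (λ x → x)) ⟩
    prodL nonzeros (λ x → a * x)               ≡⟨ sym (∏.fold-map (a *_) nonzeros (λ x → x)) ⟩
    prodL (map (a *_) nonzeros) (λ x → x)      ≡⟨ ∏.fold-↭ (λ x → x) (map-*-↭ a≢0 nonzeros-unique
                                                    (λ x∈ → ∈nonzeros⁺ (*-≢0 a≢0 (∈nonzeros⁻ x∈)))
                                                    (λ x∈ → ∈nonzeros⁺ (*-≢0 (⁻¹-≢0 a≢0) (∈nonzeros⁻ x∈)))) ⟩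
    P                                          ≡⟨ sym (*-identityʳ _) ⟩
    P * 1#                                     ∎)
    where
    P = prodL nonzeros (λ x → x)

  fermat : ∀ x → x ^ card ≡ x
  fermat x with x ≟ 0#
  ... | yes refl = ≡-trans (cong (0# ^_) card≡1+length-nonzeros) (zeroˡ _)
  ... | no  x≢0  = ≡-trans (cong (x ^_) card≡1+length-nonzeros)
                           (≡-trans (cong (x *_) (x^length-nonzeros≡1 x x≢0)) (*-identityʳ x))

  open SumProperties (CommutativeRing.+-monoid commutativeRing) public
    using (sum; sum-cong-≗; sum-init-last; sum-replicate-zero)

  binomial-theorem : ∀ n x y →
    (x + y) ^ n ≡ sum (λ (i : Fin (suc n)) → ⟦ n C toℕ i ⟧ℕ * (x ^ toℕ i * y ^ (n ℕ.∸ toℕ i)))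
  binomial-theorem n x y = begin
    (x + y) ^ n                      ≡⟨ sym (^≡^ (x + y) n) ⟩
    (x + y) Exp.^ n                  ≡⟨ Binomial.theorem n x y ⟩
    Binomial.binomialExpansion x y n ≡⟨ sum-cong-≗ term≡ ⟩
    _                                ∎
    where
    semiring = CommutativeRing.semiring commutativeRing
    module Exp = ExpProperties semiring
    module Mult = MultProperties semiring
    module Binomial = BinomialProperties (CommutativeRing.commutativeSemiring commutativeRing)
    ^≡^ : ∀ x k → x Exp.^ k ≡ x ^ k
    ^≡^ x zero    = refl
    ^≡^ x (suc k) = cong (x *_) (^≡^ x k)
    ×≡⟦⟧* : ∀ k x → k Mult.× x ≡ ⟦ k ⟧ℕ * x
    ×≡⟦⟧* zero    x = sym (zeroˡ x)
    ×≡⟦⟧* (suc k) x = begin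
      x + k Mult.× x            ≡⟨ cong₂ _+_ (sym (*-identityˡ x)) (×≡⟦⟧* k x) ⟩
      1# * x + ⟦ k ⟧ℕ * x       ≡⟨ sym (distribʳ x 1# ⟦ k ⟧ℕ) ⟩
      (1# + ⟦ k ⟧ℕ) * x         ≡⟨ cong (_* x) (sym (⟦suc⟧ℕ k)) ⟩
      ⟦ suc k ⟧ℕ * x            ∎
    term≡ : ∀ i → Binomial.binomialTerm x y n i ≡ ⟦ n C toℕ i ⟧ℕ * (x ^ toℕ i * y ^ (n ℕ.∸ toℕ i))
    term≡ i = ≡-trans (×≡⟦⟧* (n C toℕ i) _)
      (cong (⟦ n C toℕ i ⟧ℕ *_) (cong₂ _*_ (^≡^ x (toℕ i)) (^≡^ y (n ℕ.∸ toℕ i))))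

  sum-last : ∀ {n} (t : Fin (suc n) → Carrier) → (∀ i → t (Fin.inject₁ i) ≡ 0#) → sum t ≡ t (Fin.fromℕ n)
  sum-last {n} t init≡0 = begin
    sum t
      ≡⟨ sum-init-last t ⟩
    sum (t ∘ Fin.inject₁) + t (Fin.fromℕ n)
      ≡⟨ cong (_+ t (Fin.fromℕ n)) (≡-trans (sum-cong-≗ init≡0) (sum-replicate-zero n)) ⟩
    0# + t (Fin.fromℕ n)
      ≡⟨ +-identityˡ _ ⟩
    t (Fin.fromℕ n) ∎

  frobenius : ∀ {p} → Prime p → ⟦ p ⟧ℕ ≡ 0# → ∀ x y → (x + y) ^ p ≡ x ^ p + y ^ p
  frobenius {suc p} p-prime ⟦p⟧≡0 x y = begin
    (x + y) ^ suc p                      ≡⟨ binomial-theorem (suc p) x y ⟩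
    term Fin.zero + sum (term ∘ Fin.suc) ≡⟨ cong (term Fin.zero +_) (sum-last (term ∘ Fin.suc) middle≡0) ⟩
    term Fin.zero + term (Fin.fromℕ (suc p)) ≡⟨ cong₂ _+_ term₀ termₚ ⟩
    y ^ suc p + x ^ suc p                ≡⟨ +-comm _ _ ⟩
    x ^ suc p + y ^ suc p                ∎
    where
    term : Fin (suc (suc p)) → Carrier
    term i = ⟦ suc p C toℕ i ⟧ℕ * (x ^ toℕ i * y ^ (suc p ℕ.∸ toℕ i))
    middle≡0 : ∀ i → term (Fin.suc (Fin.inject₁ i)) ≡ 0#
    middle≡0 i with p∣pCk p-prime (s≤s ℕ.z≤n) (s≤s (subst (_< p) (sym (Fin.toℕ-inject₁ i)) (Fin.toℕ<n i)))
    ... | divides c pCi≡c*p = begin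
      ⟦ suc p C toℕ j ⟧ℕ * b    ≡⟨ cong (λ k → ⟦ k ⟧ℕ * b) pCi≡c*p ⟩
      ⟦ c ℕ.* suc p ⟧ℕ * b      ≡⟨ cong (_* b) (≡-trans (⟦*⟧ℕ c (suc p)) (cong (⟦ c ⟧ℕ *_) ⟦p⟧≡0)) ⟩
      (⟦ c ⟧ℕ * 0#) * b         ≡⟨ solve 2 (λ c b → (c :* 𝟘) :* b := 𝟘) refl ⟦ c ⟧ℕ b ⟩
      0#                        ∎
      where
      j = Fin.suc (Fin.inject₁ i)
      b = x ^ toℕ j * y ^ (suc p ℕ.∸ toℕ j)
    term₀ : term Fin.zero ≡ y ^ suc p
    term₀ = solve 1 (λ Y → 𝟙 :* (𝟙 :* Y) := Y) refl (y ^ suc p)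
    termₚ : term (Fin.fromℕ (suc p)) ≡ x ^ suc p
    termₚ = begin
      term (Fin.fromℕ (suc p))
        ≡⟨ cong (λ k → ⟦ suc p C k ⟧ℕ * (x ^ k * y ^ (suc p ℕ.∸ k))) (Fin.toℕ-fromℕ (suc p)) ⟩
      ⟦ suc p C suc p ⟧ℕ * (x ^ suc p * y ^ (suc p ℕ.∸ suc p))
        ≡⟨ cong₂ (λ a b → ⟦ a ⟧ℕ * (x ^ suc p * y ^ b)) (nCn≡1 (suc p)) (ℕ.n∸n≡0 (suc p)) ⟩
      1# * (x ^ suc p * 1#)
        ≡⟨ solve 1 (λ X → 𝟙 :* (X :* 𝟙) := X) refl (x ^ suc p) ⟩
      x ^ suc p ∎

  sumL-sum-comm : ∀ xs {k} (f : Carrier → Fin k → Carrier) →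
                  sumL xs (λ c → sum (f c)) ≡ sum (λ i → sumL xs (λ c → f c i))
  sumL-sum-comm xs {zero}  f = ∑.fold-ε xs
  sumL-sum-comm xs {suc k} f =
    ≡-trans (∑.fold-distrib xs (λ c → f c Fin.zero) (λ c → sum (f c ∘ Fin.suc)))
            (cong (sumL xs (λ c → f c Fin.zero) +_) (sumL-sum-comm xs (λ c → f c ∘ Fin.suc)))

module Polynomials (K : FiniteField) where

  open FieldProperties K
  open ≡-Reasoning

  eval : List Carrier → Carrier → Carrier
  eval []       x = 0#
  eval (c ∷ cs) x = c + x * eval cs x

  _+ₚ_ : List Carrier → List Carrier → List Carrier
  []       +ₚ bs       = bs
  (a ∷ as) +ₚ []       = a ∷ as
  (a ∷ as) +ₚ (b ∷ bs) = (a + b) ∷ (as +ₚ bs)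

  _·ₚ_ : Carrier → List Carrier → List Carrier
  c ·ₚ cs = map (c *_) cs

  monomial : ℕ → Carrier → List Carrier
  monomial d c = replicate d 0# ++ [ c ]

  HasLeadingCoefficient : List Carrier → Carrier → Set
  HasLeadingCoefficient cs c = ∃ λ ds → cs ≡ ds ++ [ c ]

  eval-+ₚ : ∀ as bs x → eval (as +ₚ bs) x ≡ eval as x + eval bs x
  eval-+ₚ []       bs       x = sym (+-identityˡ _)
  eval-+ₚ (a ∷ as) []       x = sym (+-identityʳ _)
  eval-+ₚ (a ∷ as) (b ∷ bs) x = begin
    (a + b) + x * eval (as +ₚ bs) x
      ≡⟨ cong (λ t → (a + b) + x * t) (eval-+ₚ as bs x) ⟩
    (a + b) + x * (eval as x + eval bs x)
      ≡⟨ solve 5 (λ a b x u v → (a :+ b) :+ x :* (u :+ v) := (a :+ x :* u) :+ (b :+ x :* v)) refl a b x (eval as x) (eval bs x) ⟩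
    (a + x * eval as x) + (b + x * eval bs x) ∎

  eval-·ₚ : ∀ c cs x → eval (c ·ₚ cs) x ≡ c * eval cs x
  eval-·ₚ c []       x = sym (zeroʳ c)
  eval-·ₚ c (d ∷ cs) x = begin
    c * d + x * eval (c ·ₚ cs) x
      ≡⟨ cong (λ t → c * d + x * t) (eval-·ₚ c cs x) ⟩
    c * d + x * (c * eval cs x)
      ≡⟨ solve 4 (λ c d x u → c :* d :+ x :* (c :* u) := c :* (d :+ x :* u)) refl c d x (eval cs x) ⟩
    c * (d + x * eval cs x) ∎

  eval-replicate0 : ∀ d cs x → eval (replicate d 0# ++ cs) x ≡ x ^ d * eval cs x
  eval-replicate0 zero    cs x = sym (*-identityˡ _)
  eval-replicate0 (suc d) cs x = begin
    0# + x * eval (replicate d 0# ++ cs) x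
      ≡⟨ cong (λ t → 0# + x * t) (eval-replicate0 d cs x) ⟩
    0# + x * (x ^ d * eval cs x)
      ≡⟨ solve 3 (λ x X e → 𝟘 :+ x :* (X :* e) := (x :* X) :* e) refl x (x ^ d) (eval cs x) ⟩
    x ^ suc d * eval cs x ∎

  eval-monomial : ∀ d c x → eval (monomial d c) x ≡ c * x ^ d
  eval-monomial d c x = ≡-trans (eval-replicate0 d [ c ] x) (solve 3 (λ X c x → X :* (c :+ x :* 𝟘) := c :* X) refl (x ^ d) c x)

  eval-allZero : ∀ {cs} → All (_≡ 0#) cs → ∀ x → eval cs x ≡ 0#
  eval-allZero []             x = refl
  eval-allZero {c ∷ cs} (c≡0 ∷ allZero) x = begin
    c + x * eval cs x ≡⟨ cong₂ (λ u v → u + x * v) c≡0 (eval-allZero allZero x) ⟩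
    0# + x * 0#       ≡⟨ solve 1 (λ x → 𝟘 :+ x :* 𝟘 := 𝟘) refl x ⟩
    0#                ∎

  length-+ₚ≤ : ∀ {k} as bs → length as ≤ k → length bs ≤ k → length (as +ₚ bs) ≤ k
  length-+ₚ≤ []       bs       _         bs≤k      = bs≤k
  length-+ₚ≤ (a ∷ as) []       as≤k      _         = as≤k
  length-+ₚ≤ (a ∷ as) (b ∷ bs) (s≤s as≤k) (s≤s bs≤k) = s≤s (length-+ₚ≤ as bs as≤k bs≤k)

  length-monomial : ∀ d c → length (monomial d c) ≡ suc d
  length-monomial d c = ≡-trans (List.length-++ (replicate d 0#))
    (≡-trans (cong (ℕ._+ 1) (List.length-replicate d)) (ℕ.+-comm d 1))

  -- Synthetic division by x - r; the remainder is eval cs r.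
  quotient : List Carrier → Carrier → List Carrier
  quotient []                 r = []
  quotient (c ∷ [])           r = []
  quotient (c ∷ cs@(_ ∷ _))   r = eval cs r ∷ quotient cs r

  eval-quotient : ∀ cs r x → eval cs x ≡ (x - r) * eval (quotient cs r) x + eval cs r
  eval-quotient []               r x = solve 2 (λ x r → 𝟘 := (x :- r) :* 𝟘 :+ 𝟘) refl x r
  eval-quotient (c ∷ [])         r x = solve 3 (λ c x r → c :+ x :* 𝟘 := (x :- r) :* 𝟘 :+ (c :+ r :* 𝟘)) refl c x r
  eval-quotient (c ∷ cs@(_ ∷ _)) r x = begin
    c + x * eval cs x
      ≡⟨ cong (λ t → c + x * t) (eval-quotient cs r x) ⟩
    c + x * ((x - r) * Q + R)
      ≡⟨ solve 5 (λ c x r Q R → c :+ x :* ((x :- r) :* Q :+ R) := (x :- r) :* (R :+ x :* Q) :+ (c :+ r :* R)) refl c x r Q R ⟩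
    (x - r) * (R + x * Q) + (c + r * R) ∎
    where
    Q = eval (quotient cs r) x
    R = eval cs r

  length-quotient : ∀ cs r → length (quotient cs r) ≡ ℕ.pred (length cs)
  length-quotient []               r = refl
  length-quotient (c ∷ [])         r = refl
  length-quotient (c ∷ cs@(_ ∷ _)) r = cong suc (length-quotient cs r)

  quotient-zero : ∀ cs r → All (_≡ 0#) (quotient cs r) → eval cs r ≡ 0# → All (_≡ 0#) cs
  quotient-zero []               r _              _ = []
  quotient-zero (c ∷ [])         r _              c+r0≡0 =
    ≡-trans (solve 2 (λ c r → c := c :+ r :* 𝟘) refl c r) c+r0≡0 ∷ []
  quotient-zero (c ∷ cs@(_ ∷ _)) r (cs[r]≡0 ∷ qz) c+rcs[r]≡0 = c≡0 ∷ quotient-zero cs r qz cs[r]≡0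
    where
    c≡0 : c ≡ 0#
    c≡0 = begin
      c                   ≡⟨ solve 2 (λ c r → c := c :+ r :* 𝟘) refl c r ⟩
      c + r * 0#          ≡⟨ cong (λ t → c + r * t) (sym cs[r]≡0) ⟩
      c + r * eval cs r   ≡⟨ c+rcs[r]≡0 ⟩
      0#                  ∎

  roots⇒zero : ∀ cs {rs} → Unique rs → All (λ r → eval cs r ≡ 0#) rs → length cs ≤ length rs → All (_≡ 0#) cs
  roots⇒zero []           _               _              _  = []
  roots⇒zero (c ∷ cs)     {[]}     _      _              ()
  roots⇒zero cs@(_ ∷ _) {r ∷ rs} (r∉rs ∷ urs) (cs[r]≡0 ∷ roots) (s≤s len≤) =
    quotient-zero cs r (roots⇒zero (quotient cs r) urs (All.zipWith quotient-root (r∉rs , roots))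
                                   (subst (_≤ length rs) (sym (length-quotient cs r)) len≤))
                  cs[r]≡0
    where
    quotient-root : ∀ {r′} → r ≢ r′ × eval cs r′ ≡ 0# → eval (quotient cs r) r′ ≡ 0#
    quotient-root {r′} (r≢r′ , cs[r′]≡0)
      with x*y≡0⇒x≡0⊎y≡0 (r′ - r) (eval (quotient cs r) r′) (begin
        (r′ - r) * eval (quotient cs r) r′
          ≡⟨ solve 2 (λ a b → a := a :+ b :- b) refl _ (eval cs r) ⟩
        (r′ - r) * eval (quotient cs r) r′ + eval cs r - eval cs r
          ≡⟨ cong (_- eval cs r) (sym (eval-quotient cs r r′)) ⟩
        eval cs r′ - eval cs r
          ≡⟨ cong₂ _-_ cs[r′]≡0 cs[r]≡0 ⟩
        0# - 0#
          ≡⟨ -‿inverseʳ 0# ⟩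
        0# ∎)
    ... | inj₁ r′-r≡0 = ⊥-elim (r≢r′ (sym (x-y≡0⇒x≡y r′-r≡0)))
    ... | inj₂ q[r′]≡0 = q[r′]≡0

  roots<length : ∀ cs {c rs} → HasLeadingCoefficient cs c → c ≢ 0# → Unique rs →
                 All (λ r → eval cs r ≡ 0#) rs → length rs < length cs
  roots<length cs {c} {rs} (ds , refl) c≢0 urs roots with ℕ.<-≤-connex (length rs) (length cs)
  ... | inj₁ rs<cs = rs<cs
  ... | inj₂ cs≤rs = ⊥-elim (c≢0 (last-zero ds (roots⇒zero cs (Unique.take⁺ k urs) (All.take⁺ k roots)
                       (ℕ.≤-reflexive (sym (≡-trans (List.length-take k rs) (ℕ.m≤n⇒m⊓n≡m cs≤rs)))))))
    where
    k = length cs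
    last-zero : ∀ ds → All (_≡ 0#) (ds ++ [ c ]) → c ≡ 0#
    last-zero []       (c≡0 ∷ _) = c≡0
    last-zero (d ∷ ds) (_ ∷ zs)  = last-zero ds zs

  length-roots-of-unity≤ : ∀ {e rs} → 1 ≤ e → Unique rs → All (λ r → r ^ e ≡ 1#) rs → length rs ≤ e
  length-roots-of-unity≤ {suc j} {rs} (s≤s ℕ.z≤n) urs unity = ℕ.≤-pred
    (subst (length rs <_) (cong suc (length-monomial j 1#))
      (roots<length xʲ⁺¹-1 (- 1# ∷ replicate j 0# , refl) 1≢0 urs (All.map root unity)))
    where
    xʲ⁺¹-1 = - 1# ∷ monomial j 1#
    root : ∀ {r} → r ^ suc j ≡ 1# → eval xʲ⁺¹-1 r ≡ 0#
    root {r} rʲ⁺¹≡1 = begin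
      - 1# + r * eval (monomial j 1#) r
        ≡⟨ cong (λ t → - 1# + r * t) (eval-monomial j 1# r) ⟩
      - 1# + r * (1# * r ^ j)
        ≡⟨ solve 2 (λ r X → :- 𝟙 :+ r :* (𝟙 :* X) := :- 𝟙 :+ r :* X) refl r (r ^ j) ⟩
      - 1# + r ^ suc j
        ≡⟨ cong (- 1# +_) rʲ⁺¹≡1 ⟩
      - 1# + 1#
        ≡⟨ -‿inverseˡ 1# ⟩
      0# ∎

  -- Σ_{i ≤ M} x^((d+1) i)
  geometric : ℕ → ℕ → List Carrier
  geometric d zero    = [ 1# ]
  geometric d (suc M) = 1# ∷ (replicate d 0# ++ geometric d M)

  eval-geometric : ∀ d M x → (x ^ suc d - 1#) * eval (geometric d M) x ≡ x ^ (suc d ℕ.* suc M) - 1#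
  eval-geometric d zero    x = begin
    (x ^ suc d - 1#) * (1# + x * 0#)
      ≡⟨ solve 2 (λ X x → (X :- 𝟙) :* (𝟙 :+ x :* 𝟘) := X :- 𝟙) refl (x ^ suc d) x ⟩
    x ^ suc d - 1#
      ≡⟨ cong (λ k → x ^ k - 1#) (sym (ℕ.*-identityʳ (suc d))) ⟩
    x ^ (suc d ℕ.* 1) - 1# ∎
  eval-geometric d (suc M) x = begin
    (X - 1#) * (1# + x * eval (replicate d 0# ++ geometric d M) x)
      ≡⟨ cong (λ t → (X - 1#) * (1# + x * t)) (eval-replicate0 d (geometric d M) x) ⟩
    (X - 1#) * (1# + x * (x ^ d * H))
      ≡⟨ solve 4 (λ X x Xd H → (X :- 𝟙) :* (𝟙 :+ x :* (Xd :* H)) := (X :- 𝟙) :+ (x :* Xd) :* ((X :- 𝟙) :* H))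
                 refl X x (x ^ d) H ⟩
    (X - 1#) + X * ((X - 1#) * H)
      ≡⟨ cong (λ t → (X - 1#) + X * t) (eval-geometric d M x) ⟩
    (X - 1#) + X * (x ^ (suc d ℕ.* suc M) - 1#)
      ≡⟨ solve 2 (λ X Y → (X :- 𝟙) :+ X :* (Y :- 𝟙) := X :* Y :- 𝟙) refl X (x ^ (suc d ℕ.* suc M)) ⟩
    X * x ^ (suc d ℕ.* suc M) - 1#
      ≡⟨ cong (_- 1#) (sym (^-distribˡ-+-* x (suc d) (suc d ℕ.* suc M))) ⟩
    x ^ (suc d ℕ.+ suc d ℕ.* suc M) - 1#
      ≡⟨ cong (λ k → x ^ k - 1#) (sym (ℕ.*-suc (suc d) (suc M))) ⟩
    x ^ (suc d ℕ.* suc (suc M)) - 1# ∎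
    where
    X = x ^ suc d
    H = eval (geometric d M) x

  length-geometric : ∀ d M → length (geometric d M) ≡ suc (M ℕ.* suc d)
  length-geometric d zero    = refl
  length-geometric d (suc M) = cong suc (≡-trans (List.length-++ (replicate d 0#))
    (≡-trans (cong₂ ℕ._+_ (List.length-replicate d) (length-geometric d M)) (ℕ.+-suc d (M ℕ.* suc d))))

  geometric-leading : ∀ d M → HasLeadingCoefficient (geometric d M) 1#
  geometric-leading d zero    = [] , refl
  geometric-leading d (suc M) with geometric-leading d M
  ... | ds , eq = 1# ∷ (replicate d 0# ++ ds) ,
                  cong (1# ∷_) (≡-trans (cong (replicate d 0# ++_) eq) (sym (List.++-assoc (replicate d 0#) ds [ 1# ])))

  length-nonunity≤ : ∀ {e} M {rs} → 1 ≤ e → Unique rs →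
                     All (λ r → r ^ (e ℕ.* suc M) ≡ 1# × r ^ e ≢ 1#) rs → length rs ≤ M ℕ.* e
  length-nonunity≤ {suc d} M {rs} (s≤s ℕ.z≤n) urs roots = ℕ.≤-pred
    (subst (length rs <_) (length-geometric d M)
      (roots<length (geometric d M) (geometric-leading d M) 1≢0 urs (All.map root roots)))
    where
    root : ∀ {r} → r ^ (suc d ℕ.* suc M) ≡ 1# × r ^ suc d ≢ 1# → eval (geometric d M) r ≡ 0#
    root {r} (r^N≡1 , r^d≢1)
      with x*y≡0⇒x≡0⊎y≡0 (r ^ suc d - 1#) (eval (geometric d M) r)
             (≡-trans (eval-geometric d M r) (≡-trans (cong (_- 1#) r^N≡1) (-‿inverseʳ 1#)))
    ... | inj₁ r^d-1≡0 = ⊥-elim (r^d≢1 (x-y≡0⇒x≡y r^d-1≡0))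
    ... | inj₂ H[r]≡0  = H[r]≡0

  -- The coefficients of ∏_{c ∈ cs} (x - c) below the leading one.
  lowerTerms : List Carrier → List Carrier
  lowerTerms []       = []
  lowerTerms (c ∷ cs) = (0# ∷ lowerTerms cs) +ₚ (monomial (length cs) (- c) +ₚ ((- c) ·ₚ lowerTerms cs))

  prod-linear : ∀ cs x → prodL cs (λ c → x - c) ≡ x ^ length cs + eval (lowerTerms cs) x
  prod-linear []       x = sym (+-identityʳ 1#)
  prod-linear (c ∷ cs) x = begin
    (x - c) * prodL cs (λ c → x - c)
      ≡⟨ cong ((x - c) *_) (prod-linear cs x) ⟩
    (x - c) * (x ^ d + L)
      ≡⟨ solve 4 (λ x c X L → (x :- c) :* (X :+ L) := x :* X :+ ((𝟘 :+ x :* L) :+ ((:- c) :* X :+ (:- c) :* L)))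
                 refl x c (x ^ d) L ⟩
    x ^ suc d + ((0# + x * L) + ((- c) * x ^ d + (- c) * L))
      ≡⟨ cong (x ^ suc d +_) (sym eval-lower) ⟩
    x ^ suc d + eval (lowerTerms (c ∷ cs)) x ∎
    where
    d = length cs
    L = eval (lowerTerms cs) x
    eval-lower : eval (lowerTerms (c ∷ cs)) x ≡ (0# + x * L) + ((- c) * x ^ d + (- c) * L)
    eval-lower = ≡-trans (eval-+ₚ (0# ∷ lowerTerms cs) (monomial d (- c) +ₚ ((- c) ·ₚ lowerTerms cs)) x)
      (cong ((0# + x * L) +_) (≡-trans (eval-+ₚ (monomial d (- c)) ((- c) ·ₚ lowerTerms cs) x)
        (cong₂ _+_ (eval-monomial d (- c) x) (eval-·ₚ (- c) (lowerTerms cs) x))))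

  length-lowerTerms≤ : ∀ cs → length (lowerTerms cs) ≤ length cs
  length-lowerTerms≤ []       = ℕ.z≤n
  length-lowerTerms≤ (c ∷ cs) =
    length-+ₚ≤ (0# ∷ lowerTerms cs) (monomial (length cs) (- c) +ₚ ((- c) ·ₚ lowerTerms cs))
      (s≤s (length-lowerTerms≤ cs))
      (length-+ₚ≤ (monomial (length cs) (- c)) ((- c) ·ₚ lowerTerms cs)
        (ℕ.≤-reflexive (length-monomial (length cs) (- c)))
        (ℕ.≤-trans (ℕ.≤-reflexive (List.length-map (- c *_) (lowerTerms cs))) (ℕ.m≤n⇒m≤1+n (length-lowerTerms≤ cs))))

  prod-roots-of-unity : ∀ {rs} → Unique rs → 1 ≤ length rs → All (λ r → r ^ length rs ≡ 1#) rs →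
                        ∀ x → prodL rs (λ r → x - r) ≡ x ^ length rs - 1#
  prod-roots-of-unity {rs} urs 1≤n unity x = begin
    prodL rs (λ r → x - r)      ≡⟨ prod-linear rs x ⟩
    x ^ length rs + low x       ≡⟨ cong (x ^ length rs +_) (low≡-1 x) ⟩
    x ^ length rs - 1#          ∎
    where
    low = eval (lowerTerms rs)
    D = [ 1# ] +ₚ lowerTerms rs
    eval-D : ∀ y → eval D y ≡ 1# + low y
    eval-D y = ≡-trans (eval-+ₚ [ 1# ] (lowerTerms rs) y)
                       (cong (_+ low y) (solve 1 (λ y → 𝟙 :+ y :* 𝟘 := 𝟙) refl y))
    root : ∀ {r} → r ∈ rs → eval D r ≡ 0#
    root {r} r∈rs = ≡-trans (eval-D r) (begin
      1# + low r              ≡⟨ cong (_+ low r) (sym (All.lookup unity r∈rs)) ⟩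
      r ^ length rs + low r   ≡⟨ sym (prod-linear rs r) ⟩
      prodL rs (λ c → r - c)  ≡⟨ prod≡0 rs (λ c → r - c) r∈rs (-‿inverseʳ r) ⟩
      0#                      ∎)
    D≡0 : All (_≡ 0#) D
    D≡0 = roots⇒zero D urs (All.tabulate root) (length-+ₚ≤ [ 1# ] (lowerTerms rs) 1≤n (length-lowerTerms≤ rs))
    low≡-1 : ∀ y → low y ≡ - 1#
    low≡-1 y = +-inverseʳ-unique 1# (low y) (≡-trans (sym (eval-D y)) (eval-allZero D≡0 y))

module Subfield (K : FiniteField) {p m n : ℕ} (p-prime : Prime p) (1≤m : 1 ≤ m) (1≤n : 1 ≤ n)
                (card≡qⁿ : FiniteField.card K ≡ (p ℕ.^ m) ℕ.^ n) where

  open FieldProperties K public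
  open Polynomials K using (length-roots-of-unity≤; length-nonunity≤; prod-roots-of-unity)
  open ≡-Reasoning

  q : ℕ
  q = p ℕ.^ m

  open OverBase q public

  q-1 : ℕ
  q-1 = q ℕ.∸ 1

  q≥2 : 2 ≤ q
  q≥2 = ℕ.≤-trans (ℕ.nonTrivial⇒n>1 p {{prime⇒nonTrivial p-prime}})
    (ℕ.≤-trans (ℕ.≤-reflexive (sym (ℕ.^-identityʳ p))) (ℕ.^-monoʳ-≤ p {{prime⇒nonZero p-prime}} 1≤m))

  q≡1+q-1 : q ≡ suc q-1
  q≡1+q-1 = sym (ℕ.m+[n∸m]≡n (ℕ.≤-trans (s≤s z≤n) q≥2))

  1≤q-1 : 1 ≤ q-1
  1≤q-1 = ℕ.∸-monoˡ-≤ 1 q≥2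

  qᵃ≤qᵇ⇒a≤b : ∀ {a b} → q ℕ.^ a ≤ q ℕ.^ b → a ≤ b
  qᵃ≤qᵇ⇒a≤b qᵃ≤qᵇ = ℕ.≮⇒≥ (λ b<a → ℕ.<⇒≱ (ℕ.^-monoʳ-< q q≥2 b<a) qᵃ≤qᵇ)

  x^q≡x*x^q-1 : ∀ x → x ^ q ≡ x * x ^ q-1
  x^q≡x*x^q-1 x = cong (x ^_) q≡1+q-1

  0^q-1≡0 : 0# ^ q-1 ≡ 0#
  0^q-1≡0 = 0^n≡0 1≤q-1

  ⟦p⟧≡0 : ⟦ p ⟧ℕ ≡ 0#
  ⟦p⟧≡0 = x^n≡0⇒x≡0 (m ℕ.* n) (begin
    ⟦ p ⟧ℕ ^ (m ℕ.* n)     ≡⟨ sym (⟦^⟧ℕ p (m ℕ.* n)) ⟩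
    ⟦ p ℕ.^ (m ℕ.* n) ⟧ℕ   ≡⟨ cong ⟦_⟧ℕ (sym (≡-trans card≡qⁿ (ℕ.^-*-assoc p m n))) ⟩
    ⟦ card ⟧ℕ              ≡⟨ card·1≡0 ⟩
    0#                     ∎)

  ⟦q⟧≡0 : ⟦ q ⟧ℕ ≡ 0#
  ⟦q⟧≡0 = ≡-trans (⟦^⟧ℕ p m) (≡-trans (cong (_^ m) ⟦p⟧≡0) (0^n≡0 1≤m))

  ⟦q-1⟧≡-1 : ⟦ q-1 ⟧ℕ ≡ - 1#
  ⟦q-1⟧≡-1 = +-inverseʳ-unique 1# ⟦ q-1 ⟧ℕ
    (≡-trans (sym (⟦suc⟧ℕ q-1)) (≡-trans (cong ⟦_⟧ℕ (sym q≡1+q-1)) ⟦q⟧≡0))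

  frobenius-pᵏ : ∀ k x y → (x + y) ^ (p ℕ.^ k) ≡ x ^ (p ℕ.^ k) + y ^ (p ℕ.^ k)
  frobenius-pᵏ zero    x y = solve 2 (λ x y → (x :+ y) :* 𝟙 := x :* 𝟙 :+ y :* 𝟙) refl x y
  frobenius-pᵏ (suc k) x y = begin
    (x + y) ^ (p ℕ.* p ℕ.^ k)
      ≡⟨ sym (^-*-assoc (x + y) p (p ℕ.^ k)) ⟩
    ((x + y) ^ p) ^ (p ℕ.^ k)
      ≡⟨ cong (_^ (p ℕ.^ k)) (frobenius p-prime ⟦p⟧≡0 x y) ⟩
    (x ^ p + y ^ p) ^ (p ℕ.^ k)
      ≡⟨ frobenius-pᵏ k (x ^ p) (y ^ p) ⟩
    (x ^ p) ^ (p ℕ.^ k) + (y ^ p) ^ (p ℕ.^ k)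
      ≡⟨ cong₂ _+_ (^-*-assoc x p (p ℕ.^ k)) (^-*-assoc y p (p ℕ.^ k)) ⟩
    x ^ (p ℕ.* p ℕ.^ k) + y ^ (p ℕ.* p ℕ.^ k) ∎

  frobenius-q : ∀ x y → (x + y) ^ q ≡ x ^ q + y ^ q
  frobenius-q = frobenius-pᵏ m

  -‿^q : ∀ x → (- x) ^ q ≡ - (x ^ q)
  -‿^q x = +-inverseʳ-unique (x ^ q) ((- x) ^ q) (begin
    x ^ q + (- x) ^ q   ≡⟨ sym (frobenius-q x (- x)) ⟩
    (x - x) ^ q         ≡⟨ cong (_^ q) (-‿inverseʳ x) ⟩
    0# ^ q              ≡⟨ 0^n≡0 (ℕ.≤-trans (s≤s z≤n) q≥2) ⟩
    0#                  ∎)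

  [x-y]^q≡x^q-y^q : ∀ x y → (x - y) ^ q ≡ x ^ q - y ^ q
  [x-y]^q≡x^q-y^q x y = ≡-trans (frobenius-q x (- y)) (cong (x ^ q +_) (-‿^q y))

  x^qⁿ≡x : ∀ x → x ^ (q ℕ.^ n) ≡ x
  x^qⁿ≡x x = ≡-trans (cong (x ^_) (sym card≡qⁿ)) (fermat x)

  InFq-0 : InFq 0#
  InFq-0 = 0^n≡0 (ℕ.≤-trans (s≤s z≤n) q≥2)

  InFq-1 : InFq 1#
  InFq-1 = 1^n≡1 q

  InFq-+ : ∀ {a b} → InFq a → InFq b → InFq (a + b)
  InFq-+ {a} {b} aᵠ≡a bᵠ≡b = ≡-trans (frobenius-q a b) (cong₂ _+_ aᵠ≡a bᵠ≡b)

  InFq-* : ∀ {a b} → InFq a → InFq b → InFq (a * b)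
  InFq-* {a} {b} aᵠ≡a bᵠ≡b = ≡-trans (^-distribʳ-* a b q) (cong₂ _*_ aᵠ≡a bᵠ≡b)

  InFq-neg : ∀ {a} → InFq a → InFq (- a)
  InFq-neg {a} aᵠ≡a = ≡-trans (-‿^q a) (cong -_ aᵠ≡a)

  InFq-sub : ∀ {a b} → InFq a → InFq b → InFq (a - b)
  InFq-sub aᵠ≡a bᵠ≡b = InFq-+ aᵠ≡a (InFq-neg bᵠ≡b)

  InFq-⁻¹ : ∀ {a} → InFq a → a ≢ 0# → InFq (a ⁻¹)
  InFq-⁻¹ {a} aᵠ≡a a≢0 = ≡-trans (sym (⁻¹-^ q a≢0)) (cong _⁻¹ aᵠ≡a)

  InFq-^q-1 : ∀ {c} → InFq c → c ≢ 0# → c ^ q-1 ≡ 1#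
  InFq-^q-1 {c} cᵠ≡c c≢0 = *-cancelˡ c c≢0 (≡-trans (sym (x^q≡x*x^q-1 c)) (≡-trans cᵠ≡c (sym (*-identityʳ c))))

  InFq? : Decidable InFq
  InFq? c = (c ^ q) ≟ c

  𝔽q* : List Carrier
  𝔽q* = filter InFq? nonzeros

  𝔽q : List Carrier
  𝔽q = 0# ∷ 𝔽q*

  𝔽q*-unique : Unique 𝔽q*
  𝔽q*-unique = Unique.filter⁺ InFq? nonzeros-unique

  ∈𝔽q*⁻ : ∀ {c} → c ∈ 𝔽q* → InFq c × c ≢ 0#
  ∈𝔽q*⁻ c∈ with ∈-filter⁻ InFq? {xs = nonzeros} c∈
  ... | c∈nonzeros , cᵠ≡c = cᵠ≡c , ∈nonzeros⁻ c∈nonzeros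

  ∈𝔽q*⁺ : ∀ {c} → InFq c → c ≢ 0# → c ∈ 𝔽q*
  ∈𝔽q*⁺ cᵠ≡c c≢0 = ∈-filter⁺ InFq? (∈nonzeros⁺ c≢0) cᵠ≡c

  𝔽q-unique : Unique 𝔽q
  𝔽q-unique = All.tabulate (λ c∈ 0≡c → proj₂ (∈𝔽q*⁻ c∈) (sym 0≡c)) ∷ 𝔽q*-unique

  ∈𝔽q⁻ : ∀ {c} → c ∈ 𝔽q → InFq c
  ∈𝔽q⁻ (here refl) = InFq-0
  ∈𝔽q⁻ (there c∈)  = proj₁ (∈𝔽q*⁻ c∈)

  ∈𝔽q⁺ : ∀ {c} → InFq c → c ∈ 𝔽q
  ∈𝔽q⁺ {c} cᵠ≡c with c ≟ 0#
  ... | yes refl = here refl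
  ... | no  c≢0  = there (∈𝔽q*⁺ cᵠ≡c c≢0)

  ∈𝔽q*-^q-1 : ∀ {c} → c ∈ 𝔽q* → c ^ q-1 ≡ 1#
  ∈𝔽q*-^q-1 c∈ = InFq-^q-1 (proj₁ (∈𝔽q*⁻ c∈)) (proj₂ (∈𝔽q*⁻ c∈))

  length-𝔽q*≤ : length 𝔽q* ≤ q-1
  length-𝔽q*≤ = length-roots-of-unity≤ 1≤q-1 𝔽q*-unique (All.tabulate ∈𝔽q*-^q-1)

  ∑qⁱ : ℕ → ℕ
  ∑qⁱ zero    = 0
  ∑qⁱ (suc k) = suc (q ℕ.* ∑qⁱ k)

  qᵏ≡1+[q-1]*∑qⁱ : ∀ k → q ℕ.^ k ≡ suc (q-1 ℕ.* ∑qⁱ k)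
  qᵏ≡1+[q-1]*∑qⁱ zero    = cong suc (sym (ℕ.*-zeroʳ q-1))
  qᵏ≡1+[q-1]*∑qⁱ (suc k) = begin
    q ℕ.* q ℕ.^ k                                ≡⟨ cong₂ ℕ._*_ q≡1+q-1 (qᵏ≡1+[q-1]*∑qⁱ k) ⟩
    suc q-1 ℕ.* suc (q-1 ℕ.* G)                  ≡⟨ [1+d][1+dG]≡1+d[1+[1+d]G] q-1 G ⟩
    suc (q-1 ℕ.* suc (suc q-1 ℕ.* G))            ≡⟨ cong (λ Q → suc (q-1 ℕ.* suc (Q ℕ.* G))) (sym q≡1+q-1) ⟩
    suc (q-1 ℕ.* suc (q ℕ.* G))                  ∎
    where
    G = ∑qⁱ k

  M : ℕ
  M = q ℕ.* ∑qⁱ (ℕ.pred n)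

  qⁿ≡1+[q-1]*[1+M] : q ℕ.^ n ≡ suc (q-1 ℕ.* suc M)
  qⁿ≡1+[q-1]*[1+M] = ≡-trans (qᵏ≡1+[q-1]*∑qⁱ n)
    (cong (λ k → suc (q-1 ℕ.* ∑qⁱ k)) (sym (ℕ.suc-pred n {{ℕ.>-nonZero 1≤n}})))

  length-nonzeros≡[q-1]*[1+M] : length nonzeros ≡ q-1 ℕ.* suc M
  length-nonzeros≡[q-1]*[1+M] =
    ℕ.suc-injective (≡-trans (sym card≡1+length-nonzeros) (≡-trans card≡qⁿ qⁿ≡1+[q-1]*[1+M]))

  outside𝔽q : List Carrier
  outside𝔽q = filter (¬? ∘ InFq?) nonzeros

  outside𝔽q-nonunity : ∀ {x} → x ∈ outside𝔽q → x ^ (q-1 ℕ.* suc M) ≡ 1# × x ^ q-1 ≢ 1#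
  outside𝔽q-nonunity {x} x∈ with ∈-filter⁻ (¬? ∘ InFq?) {xs = nonzeros} x∈
  ... | x∈nonzeros , x∉𝔽q = *-cancelˡ x x≢0 x*xᴺ≡x*1 , λ xᵠ⁻¹≡1 → x∉𝔽q (begin
      x ^ q          ≡⟨ x^q≡x*x^q-1 x ⟩
      x * x ^ q-1    ≡⟨ cong (x *_) xᵠ⁻¹≡1 ⟩
      x * 1#         ≡⟨ *-identityʳ x ⟩
      x              ∎)
    where
    x≢0 : x ≢ 0#
    x≢0 = ∈nonzeros⁻ x∈nonzeros
    x*xᴺ≡x*1 : x * x ^ (q-1 ℕ.* suc M) ≡ x * 1#
    x*xᴺ≡x*1 = begin
      x ^ suc (q-1 ℕ.* suc M)   ≡⟨ cong (x ^_) (sym qⁿ≡1+[q-1]*[1+M]) ⟩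
      x ^ (q ℕ.^ n)             ≡⟨ x^qⁿ≡x x ⟩
      x                         ≡⟨ sym (*-identityʳ x) ⟩
      x * 1#                    ∎

  length-outside𝔽q≤ : length outside𝔽q ≤ M ℕ.* q-1
  length-outside𝔽q≤ = length-nonunity≤ M 1≤q-1 (Unique.filter⁺ (¬? ∘ InFq?) nonzeros-unique)
                        (All.tabulate outside𝔽q-nonunity)

  length-𝔽q* : length 𝔽q* ≡ q-1
  length-𝔽q* = ℕ.≤-antisym length-𝔽q*≤ (ℕ.+-cancelʳ-≤ (M ℕ.* q-1) q-1 (length 𝔽q*)
    (ℕ.≤-trans (ℕ.≤-reflexive (sym split)) (ℕ.+-monoʳ-≤ (length 𝔽q*) length-outside𝔽q≤)))
    where
    split : length 𝔽q* ℕ.+ length outside𝔽q ≡ q-1 ℕ.+ M ℕ.* q-1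
    split = begin
      length 𝔽q* ℕ.+ length outside𝔽q  ≡⟨ sym (length-filter+length-filter∁ InFq? nonzeros) ⟩
      length nonzeros                  ≡⟨ length-nonzeros≡[q-1]*[1+M] ⟩
      q-1 ℕ.* suc M                    ≡⟨ ℕ.*-suc q-1 M ⟩
      q-1 ℕ.+ q-1 ℕ.* M                ≡⟨ cong (q-1 ℕ.+_) (ℕ.*-comm q-1 M) ⟩
      q-1 ℕ.+ M ℕ.* q-1                ∎

  length-𝔽q : length 𝔽q ≡ q
  length-𝔽q = ≡-trans (cong suc length-𝔽q*) (sym q≡1+q-1)

  prod-𝔽q* : ∀ y → prodL 𝔽q* (λ c → y - c) ≡ y ^ q-1 - 1#
  prod-𝔽q* y = subst (λ k → prodL 𝔽q* (λ c → y - c) ≡ y ^ k - 1#) length-𝔽q*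
    (prod-roots-of-unity 𝔽q*-unique (subst (1 ≤_) (sym length-𝔽q*) 1≤q-1)
      (All.tabulate (λ {c} c∈ → ≡-trans (cong (c ^_) length-𝔽q*) (∈𝔽q*-^q-1 c∈))) y)

  prod-𝔽q : ∀ y → prodL 𝔽q (λ c → y - c) ≡ y ^ q - y
  prod-𝔽q y = begin
    (y - 0#) * prodL 𝔽q* (λ c → y - c)
      ≡⟨ cong ((y - 0#) *_) (prod-𝔽q* y) ⟩
    (y - 0#) * (y ^ q-1 - 1#)
      ≡⟨ solve 2 (λ y Y → (y :- 𝟘) :* (Y :- 𝟙) := y :* Y :- y) refl y (y ^ q-1) ⟩
    y * y ^ q-1 - y
      ≡⟨ cong (_- y) (sym (x^q≡x*x^q-1 y)) ⟩
    y ^ q - y ∎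

  wilson : prodL 𝔽q* (λ c → - c) ≡ - 1#
  wilson = begin
    prodL 𝔽q* (λ c → - c)       ≡⟨ ∏.fold-ext 𝔽q* (λ c → sym (+-identityˡ (- c))) ⟩
    prodL 𝔽q* (λ c → 0# - c)    ≡⟨ prod-𝔽q* 0# ⟩
    0# ^ q-1 - 1#               ≡⟨ cong (_- 1#) 0^q-1≡0 ⟩
    0# - 1#                     ≡⟨ +-identityˡ _ ⟩
    - 1#                        ∎

  prod-𝔽q-multiples : ∀ y β → prodL 𝔽q (λ c → y - c * β) ≡ y ^ q - β ^ q-1 * y
  prod-𝔽q-multiples y β with β ≟ 0#
  ... | yes refl = begin
    prodL 𝔽q (λ c → y - c * 0#) ≡⟨ ∏.fold-ext 𝔽q (λ c → solve 2 (λ y c → y :- c :* 𝟘 := y) refl y c) ⟩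
    prodL 𝔽q (λ _ → y)          ≡⟨ ≡-trans (prod-const 𝔽q y) (cong (y ^_) length-𝔽q) ⟩
    y ^ q                       ≡⟨ solve 2 (λ Y y → Y := Y :- 𝟘 :* y) refl (y ^ q) y ⟩
    y ^ q - 0# * y              ≡⟨ cong (λ t → y ^ q - t * y) (sym 0^q-1≡0) ⟩
    y ^ q - 0# ^ q-1 * y        ∎
  ... | no β≢0 = begin
    prodL 𝔽q (λ c → y - c * β)
      ≡⟨ ∏.fold-ext 𝔽q y-cβ≡β[z-c] ⟩
    prodL 𝔽q (λ c → β * (z - c))
      ≡⟨ ∏.fold-distrib 𝔽q (λ _ → β) (λ c → z - c) ⟩
    prodL 𝔽q (λ _ → β) * prodL 𝔽q (λ c → z - c)
      ≡⟨ cong₂ _*_ (≡-trans (prod-const 𝔽q β) (cong (β ^_) length-𝔽q)) (prod-𝔽q z) ⟩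
    β ^ q * (z ^ q - z)
      ≡⟨ cong (λ B → B * (z ^ q - z)) (x^q≡x*x^q-1 β) ⟩
    (β * β ^ q-1) * (z ^ q - z)
      ≡⟨ solve 4 (λ b B Z z → (b :* B) :* (Z :- z) := (b :* B) :* Z :- B :* (b :* z)) refl β (β ^ q-1) (z ^ q) z ⟩
    (β * β ^ q-1) * z ^ q - β ^ q-1 * (β * z)
      ≡⟨ cong₂ (λ a b → a * z ^ q - β ^ q-1 * b) (sym (x^q≡x*x^q-1 β)) βz≡y ⟩
    β ^ q * z ^ q - β ^ q-1 * y
      ≡⟨ cong (_- β ^ q-1 * y) (≡-trans (sym (^-distribʳ-* β z q)) (cong (_^ q) βz≡y)) ⟩
    y ^ q - β ^ q-1 * y ∎
    where
    z = y * β ⁻¹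
    βz≡y : β * z ≡ y
    βz≡y = begin
      β * (y * β ⁻¹)   ≡⟨ solve 3 (λ b y i → b :* (y :* i) := y :* (b :* i)) refl β y (β ⁻¹) ⟩
      y * (β * β ⁻¹)   ≡⟨ cong (y *_) (inverseʳ β β≢0) ⟩
      y * 1#           ≡⟨ *-identityʳ y ⟩
      y                ∎
    y-cβ≡β[z-c] : ∀ c → y - c * β ≡ β * (z - c)
    y-cβ≡β[z-c] c = begin
      y - c * β          ≡⟨ cong (_- c * β) (sym βz≡y) ⟩
      β * z - c * β      ≡⟨ solve 3 (λ b z c → b :* z :- c :* b := b :* (z :- c)) refl β z c ⟩
      β * (z - c)        ∎

  sum-𝔽q-scale : ∀ {a} → a ∈ 𝔽q* → ∀ f → sumL 𝔽q (λ c → f (a * c)) ≡ sumL 𝔽q f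
  sum-𝔽q-scale {a} a∈ f = ≡-trans (sym (∑.fold-map (a *_) 𝔽q f))
    (∑.fold-↭ f (map-*-↭ a≢0 𝔽q-unique
      (λ c∈ → ∈𝔽q⁺ (InFq-* aᵠ≡a (∈𝔽q⁻ c∈)))
      (λ c∈ → ∈𝔽q⁺ (InFq-* (InFq-⁻¹ aᵠ≡a a≢0) (∈𝔽q⁻ c∈)))))
    where
    aᵠ≡a : InFq a
    aᵠ≡a = proj₁ (∈𝔽q*⁻ a∈)
    a≢0 : a ≢ 0#
    a≢0 = proj₂ (∈𝔽q*⁻ a∈)

  sum-𝔽q-const : ∀ c → sumL 𝔽q (λ _ → c) ≡ 0#
  sum-𝔽q-const c = begin
    sumL 𝔽q (λ _ → c)   ≡⟨ sum-const 𝔽q c ⟩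
    ⟦ length 𝔽q ⟧ℕ * c  ≡⟨ cong (λ k → ⟦ k ⟧ℕ * c) length-𝔽q ⟩
    ⟦ q ⟧ℕ * c          ≡⟨ cong (_* c) ⟦q⟧≡0 ⟩
    0# * c              ≡⟨ zeroˡ c ⟩
    0#                  ∎

  powerSum : ℕ → Carrier
  powerSum j = sumL 𝔽q (λ c → c ^ j)

  -- For 0 < j < q - 1 some a ∈ 𝔽q* has aʲ ≠ 1, and scaling by a permutes 𝔽q.
  powerSum<q-1 : ∀ j → j < q-1 → powerSum j ≡ 0#
  powerSum<q-1 zero    _     = sum-𝔽q-const 1#
  powerSum<q-1 (suc i) j<q-1 with All.all? (λ c → (c ^ suc i) ≟ 1#) 𝔽q*
  ... | yes all-unity = ⊥-elim (ℕ.<⇒≱ j<q-1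
          (subst (_≤ suc i) length-𝔽q* (length-roots-of-unity≤ (s≤s z≤n) 𝔽q*-unique all-unity)))
  ... | no ¬all-unity with find (All.¬All⇒Any¬ (λ c → (c ^ suc i) ≟ 1#) 𝔽q* ¬all-unity)
  ...   | a , a∈ , aʲ≢1 = *-fixed⇒≡0 aʲ≢1 (begin
    a ^ j * powerSum j             ≡⟨ sym (sum-distribˡ 𝔽q (a ^ j) (_^ j)) ⟩
    sumL 𝔽q (λ c → a ^ j * c ^ j)  ≡⟨ ∑.fold-ext 𝔽q (λ c → sym (^-distribʳ-* a c j)) ⟩
    sumL 𝔽q (λ c → (a * c) ^ j)    ≡⟨ sum-𝔽q-scale a∈ (_^ j) ⟩
    powerSum j                     ∎)
    where
    j = suc i

  powerSum-q-1 : powerSum q-1 ≡ - 1#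
  powerSum-q-1 = begin
    0# ^ q-1 + sumL 𝔽q* (λ c → c ^ q-1) ≡⟨ cong₂ _+_ 0^q-1≡0 (∑.fold-cong 𝔽q* ∈𝔽q*-^q-1) ⟩
    0# + sumL 𝔽q* (λ _ → 1#)            ≡⟨ +-identityˡ _ ⟩
    sumL 𝔽q* (λ _ → 1#)                 ≡⟨ sum-const 𝔽q* 1# ⟩
    ⟦ length 𝔽q* ⟧ℕ * 1#                ≡⟨ cong (λ k → ⟦ k ⟧ℕ * 1#) length-𝔽q* ⟩
    ⟦ q-1 ⟧ℕ * 1#                       ≡⟨ ≡-trans (*-identityʳ _) ⟦q-1⟧≡-1 ⟩
    - 1#                                ∎

  sum-shifted-power : ∀ Z → sumL 𝔽q (λ c → (Z + c) ^ q-1) ≡ - 1#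
  sum-shifted-power Z = begin
    sumL 𝔽q (λ c → (Z + c) ^ q-1)
      ≡⟨ ∑.fold-ext 𝔽q (λ c → ≡-trans (cong (_^ q-1) (+-comm Z c)) (binomial-theorem q-1 c Z)) ⟩
    sumL 𝔽q (λ c → sum (term c))
      ≡⟨ sumL-sum-comm 𝔽q term ⟩
    sum (λ i → sumL 𝔽q (λ c → term c i))
      ≡⟨ sum-last (λ i → sumL 𝔽q (λ c → term c i)) (λ i → ≡-trans (column (Fin.inject₁ i)) (lower≡0 i)) ⟩
    sumL 𝔽q (λ c → term c (Fin.fromℕ q-1))
      ≡⟨ column (Fin.fromℕ q-1) ⟩
    ⟦ q-1 C toℕ (Fin.fromℕ q-1) ⟧ℕ * (powerSum (toℕ (Fin.fromℕ q-1)) * Z ^ (q-1 ℕ.∸ toℕ (Fin.fromℕ q-1)))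
      ≡⟨ cong (λ k → ⟦ q-1 C k ⟧ℕ * (powerSum k * Z ^ (q-1 ℕ.∸ k))) (Fin.toℕ-fromℕ q-1) ⟩
    ⟦ q-1 C q-1 ⟧ℕ * (powerSum q-1 * Z ^ (q-1 ℕ.∸ q-1))
      ≡⟨ cong₂ (λ a b → ⟦ a ⟧ℕ * (powerSum q-1 * Z ^ b)) (nCn≡1 q-1) (ℕ.n∸n≡0 q-1) ⟩
    1# * (powerSum q-1 * 1#)
      ≡⟨ ≡-trans (*-identityˡ _) (≡-trans (*-identityʳ _) powerSum-q-1) ⟩
    - 1# ∎
    where
    term : Carrier → Fin (suc q-1) → Carrier
    term c i = ⟦ q-1 C toℕ i ⟧ℕ * (c ^ toℕ i * Z ^ (q-1 ℕ.∸ toℕ i))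
    column : ∀ i → sumL 𝔽q (λ c → term c i) ≡ ⟦ q-1 C toℕ i ⟧ℕ * (powerSum (toℕ i) * Z ^ (q-1 ℕ.∸ toℕ i))
    column i = ≡-trans (sum-distribˡ 𝔽q _ _) (cong (⟦ q-1 C toℕ i ⟧ℕ *_) (sum-distribʳ 𝔽q _ (_^ toℕ i)))
    lower≡0 : ∀ (i : Fin q-1) → let k = toℕ (Fin.inject₁ i) in ⟦ q-1 C k ⟧ℕ * (powerSum k * Z ^ (q-1 ℕ.∸ k)) ≡ 0#
    lower≡0 i = begin
      ⟦ q-1 C k ⟧ℕ * (powerSum k * Z ^ (q-1 ℕ.∸ k))
        ≡⟨ cong (λ s → ⟦ q-1 C k ⟧ℕ * (s * Z ^ (q-1 ℕ.∸ k))) (powerSum<q-1 k k<q-1) ⟩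
      ⟦ q-1 C k ⟧ℕ * (0# * Z ^ (q-1 ℕ.∸ k))
        ≡⟨ solve 2 (λ a b → a :* (𝟘 :* b) := 𝟘) refl _ _ ⟩
      0# ∎
      where
      k = toℕ (Fin.inject₁ i)
      k<q-1 : k < q-1
      k<q-1 = subst (_< q-1) (sym (Fin.toℕ-inject₁ i)) (Fin.toℕ<n i)

  g≡invPow : ∀ {x} → x ≢ 0# → g x ≡ invPow x
  g≡invPow {x} x≢0 with x ≟ 0#
  ... | yes x≡0 = ⊥-elim (x≢0 x≡0)
  ... | no  _   = refl

  g-0 : g 0# ≡ 0#
  g-0 with 0# ≟ 0#
  ... | yes _   = refl
  ... | no  0≢0 = ⊥-elim (0≢0 refl)

  invPow-* : ∀ {s t} → s ≢ 0# → t ≢ 0# → invPow (s * t) ≡ invPow s * invPow t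
  invPow-* {s} {t} s≢0 t≢0 = ≡-trans (cong _⁻¹ (^-distribʳ-* s t q-1)) (⁻¹-distrib-* (^-≢0 q-1 s≢0) (^-≢0 q-1 t≢0))

  invPow-InFq : ∀ {c} → InFq c → c ≢ 0# → invPow c ≡ 1#
  invPow-InFq cᵠ≡c c≢0 = ≡-trans (cong _⁻¹ (InFq-^q-1 cᵠ≡c c≢0)) 1⁻¹≡1

  invPow-≢0 : ∀ {s} → s ≢ 0# → invPow s ≢ 0#
  invPow-≢0 s≢0 = ⁻¹-≢0 (^-≢0 q-1 s≢0)

  invPow-neg : ∀ {y} → y ≢ 0# → invPow (- y) ≡ invPow y
  invPow-neg {y} y≢0 = begin
    invPow (- y)              ≡⟨ cong invPow (sym (-1*x≈-x y)) ⟩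
    invPow (- 1# * y)         ≡⟨ invPow-* -1≢0 y≢0 ⟩
    invPow (- 1#) * invPow y  ≡⟨ cong (_* invPow y) (invPow-InFq (InFq-neg InFq-1) -1≢0) ⟩
    1# * invPow y             ≡⟨ *-identityˡ _ ⟩
    invPow y                  ∎

  ¬InFq-shift-≢0 : ∀ {Z c} → ¬ InFq Z → InFq c → Z + c ≢ 0#
  ¬InFq-shift-≢0 {Z} {c} Z∉𝔽q cᵠ≡c Z+c≡0 = Z∉𝔽q (subst InFq (sym Z≡-c) (InFq-neg cᵠ≡c))
    where
    Z≡-c : Z ≡ - c
    Z≡-c = ≡-trans (solve 2 (λ Z c → Z := (Z :+ c) :- c) refl Z c) (≡-trans (cong (_- c) Z+c≡0) (+-identityˡ _))

  ¬InFq⇒x^q-x≢0 : ∀ {Z} → ¬ InFq Z → Z ^ q - Z ≢ 0#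
  ¬InFq⇒x^q-x≢0 Z∉𝔽q Zᵠ-Z≡0 = Z∉𝔽q (x-y≡0⇒x≡y Zᵠ-Z≡0)

  frobenius-shift : ∀ {c} → InFq c → ∀ Z → (Z + c) ^ q ≡ Z ^ q + c
  frobenius-shift cᵠ≡c Z = ≡-trans (frobenius-q Z _) (cong (Z ^ q +_) cᵠ≡c)

  -- (Z + c)⁻¹ = ((Z + c)^(q-1) - 1) / (Z^q - Z), and the shifted powers sum to -1.
  sum-inverse-shift : ∀ Z → ¬ InFq Z → sumL 𝔽q (λ c → (Z + c) ⁻¹) ≡ - ((Z ^ q - Z) ⁻¹)
  sum-inverse-shift Z Z∉𝔽q = begin
    sumL 𝔽q (λ c → (Z + c) ⁻¹)
      ≡⟨ ∑.fold-cong 𝔽q (λ c∈ → term (∈𝔽q⁻ c∈)) ⟩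
    sumL 𝔽q (λ c → ((Z + c) ^ q-1 - 1#) * U ⁻¹)
      ≡⟨ sum-distribʳ 𝔽q (U ⁻¹) (λ c → (Z + c) ^ q-1 - 1#) ⟩
    sumL 𝔽q (λ c → (Z + c) ^ q-1 - 1#) * U ⁻¹
      ≡⟨ cong (_* U ⁻¹) (∑.fold-distrib 𝔽q _ _) ⟩
    (sumL 𝔽q (λ c → (Z + c) ^ q-1) + sumL 𝔽q (λ _ → - 1#)) * U ⁻¹
      ≡⟨ cong₂ (λ a b → (a + b) * U ⁻¹) (sum-shifted-power Z) (sum-𝔽q-const (- 1#)) ⟩
    (- 1# + 0#) * U ⁻¹
      ≡⟨ solve 1 (λ u → (:- 𝟙 :+ 𝟘) :* u := :- u) refl (U ⁻¹) ⟩
    - (U ⁻¹) ∎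
    where
    U = Z ^ q - Z
    U≢0 : U ≢ 0#
    U≢0 = ¬InFq⇒x^q-x≢0 Z∉𝔽q
    term : ∀ {c} → InFq c → (Z + c) ⁻¹ ≡ ((Z + c) ^ q-1 - 1#) * U ⁻¹
    term {c} cᵠ≡c = sym (inverseʳ-unique w (X * U ⁻¹) (begin
      w * (X * U ⁻¹)      ≡⟨ sym (*-assoc w X (U ⁻¹)) ⟩
      (w * X) * U ⁻¹      ≡⟨ cong (_* U ⁻¹) wX≡U ⟩
      U * U ⁻¹            ≡⟨ inverseʳ U U≢0 ⟩
      1#                  ∎))
      where
      w = Z + c
      X = w ^ q-1 - 1#
      wX≡U : w * X ≡ U
      wX≡U = begin
        w * (w ^ q-1 - 1#)     ≡⟨ solve 2 (λ w W → w :* (W :- 𝟙) := w :* W :- w) refl w (w ^ q-1) ⟩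
        w * w ^ q-1 - w        ≡⟨ cong (_- w) (sym (x^q≡x*x^q-1 w)) ⟩
        w ^ q - w              ≡⟨ cong (_- w) (frobenius-shift cᵠ≡c Z) ⟩
        (Z ^ q + c) - (Z + c)  ≡⟨ solve 3 (λ A Z c → (A :+ c) :- (Z :+ c) := A :- Z) refl (Z ^ q) Z c ⟩
        U                      ∎

  -- Writing Z = z^q, each term is g (z + c) = (z + c) / (Z + c) = 1 + (z - Z) / (Z + c).
  sum-g-coset : ∀ z → ¬ InFq z → sumL 𝔽q (λ c → g (z + c)) ≡ invPow (z ^ q - z)
  sum-g-coset z z∉𝔽q = begin
    sumL 𝔽q (λ c → g (z + c))
      ≡⟨ ∑.fold-cong 𝔽q (λ c∈ → term (∈𝔽q⁻ c∈)) ⟩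
    sumL 𝔽q (λ c → 1# + (z - Z) * (Z + c) ⁻¹)
      ≡⟨ ∑.fold-distrib 𝔽q _ _ ⟩
    sumL 𝔽q (λ _ → 1#) + sumL 𝔽q (λ c → (z - Z) * (Z + c) ⁻¹)
      ≡⟨ cong₂ _+_ (sum-𝔽q-const 1#) (sum-distribˡ 𝔽q _ _) ⟩
    0# + (z - Z) * sumL 𝔽q (λ c → (Z + c) ⁻¹)
      ≡⟨ cong (λ t → 0# + (z - Z) * t) (sum-inverse-shift Z Z∉𝔽q) ⟩
    0# + (z - Z) * - ((Z ^ q - Z) ⁻¹)
      ≡⟨ solve 3 (λ z Z V → 𝟘 :+ (z :- Z) :* (:- V) := (Z :- z) :* V) refl z Z ((Z ^ q - Z) ⁻¹) ⟩
    u * (Z ^ q - Z) ⁻¹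
      ≡⟨ cong (λ t → u * t ⁻¹) (sym ([x-y]^q≡x^q-y^q Z z)) ⟩
    u * (u ^ q) ⁻¹
      ≡⟨ cong (λ t → u * t ⁻¹) (x^q≡x*x^q-1 u) ⟩
    u * (u * u ^ q-1) ⁻¹
      ≡⟨ cong (u *_) (⁻¹-distrib-* u≢0 (^-≢0 q-1 u≢0)) ⟩
    u * (u ⁻¹ * invPow u)
      ≡⟨ sym (*-assoc _ _ _) ⟩
    (u * u ⁻¹) * invPow u
      ≡⟨ cong (_* invPow u) (inverseʳ u u≢0) ⟩
    1# * invPow u
      ≡⟨ *-identityˡ _ ⟩
    invPow u ∎
    where
    Z = z ^ q
    u = z ^ q - z
    u≢0 : u ≢ 0#
    u≢0 = ¬InFq⇒x^q-x≢0 z∉𝔽q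
    Z∉𝔽q : ¬ InFq Z
    Z∉𝔽q Zᵠ≡Z = u≢0 (x^n≡0⇒x≡0 q (≡-trans ([x-y]^q≡x^q-y^q Z z) (≡-trans (cong (_- Z) Zᵠ≡Z) (-‿inverseʳ Z))))
    term : ∀ {c} → InFq c → g (z + c) ≡ 1# + (z - Z) * (Z + c) ⁻¹
    term {c} cᵠ≡c = begin
      g w
        ≡⟨ g≡invPow (¬InFq-shift-≢0 z∉𝔽q cᵠ≡c) ⟩
      (w ^ q-1) ⁻¹
        ≡⟨ sym (inverseʳ-unique (w ^ q-1) (w * W ⁻¹) wᵠ⁻¹[wW⁻¹]≡1) ⟩
      w * W ⁻¹
        ≡⟨ cong (_* W ⁻¹) (solve 3 (λ z Z c → z :+ c := (Z :+ c) :+ (z :- Z)) refl z Z c) ⟩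
      (W + (z - Z)) * W ⁻¹
        ≡⟨ distribʳ (W ⁻¹) W (z - Z) ⟩
      W * W ⁻¹ + (z - Z) * W ⁻¹
        ≡⟨ cong (_+ (z - Z) * W ⁻¹) (inverseʳ W W≢0) ⟩
      1# + (z - Z) * W ⁻¹ ∎
      where
      w = z + c
      W = Z + c
      W≢0 : W ≢ 0#
      W≢0 = ¬InFq-shift-≢0 Z∉𝔽q cᵠ≡c
      wᵠ⁻¹[wW⁻¹]≡1 : w ^ q-1 * (w * W ⁻¹) ≡ 1#
      wᵠ⁻¹[wW⁻¹]≡1 = begin
        w ^ q-1 * (w * W ⁻¹)
          ≡⟨ solve 3 (λ A w B → A :* (w :* B) := (w :* A) :* B) refl (w ^ q-1) w (W ⁻¹) ⟩
        (w * w ^ q-1) * W ⁻¹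
          ≡⟨ cong (_* W ⁻¹) (sym (x^q≡x*x^q-1 w)) ⟩
        w ^ q * W ⁻¹
          ≡⟨ cong (_* W ⁻¹) (frobenius-shift cᵠ≡c z) ⟩
        W * W ⁻¹
          ≡⟨ inverseʳ W W≢0 ⟩
        1# ∎

module SubspacePolynomials (K : FiniteField) {p m n : ℕ} (p-prime : Prime p) (1≤m : 1 ≤ m) (1≤n : 1 ≤ n)
                           (card≡qⁿ : FiniteField.card K ≡ (p ℕ.^ m) ℕ.^ n) where

  open Subfield K p-prime 1≤m 1≤n card≡qⁿ public
  open ≡-Reasoning

  -- All 𝔽q-linear combinations of bs, with repetitions unless bs is independent.
  span : List Carrier → List Carrier
  span []       = [ 0# ]
  span (a ∷ bs) = concatMap (λ c → map (λ v → c * a + v) (span bs)) 𝔽q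

  0*a+v≡v : ∀ a v → 0# * a + v ≡ v
  0*a+v≡v = solve 2 (λ a v → 𝟘 :* a :+ v := v) refl

  ∈-span-∷⁺ : ∀ a bs {c v} → InFq c → v ∈ span bs → c * a + v ∈ span (a ∷ bs)
  ∈-span-∷⁺ a bs {c} cᵠ≡c v∈ =
    ∈-concat⁺′ (∈-map⁺ (λ v → c * a + v) v∈)
               (∈-map⁺ (λ c → map (λ v → c * a + v) (span bs)) (∈𝔽q⁺ cᵠ≡c))

  ∈-span-∷⁻ : ∀ a bs {x} → x ∈ span (a ∷ bs) → ∃ λ c → ∃ λ v → InFq c × v ∈ span bs × x ≡ c * a + v
  ∈-span-∷⁻ a bs x∈ with ∈-concat⁻′ (map (λ c → map (λ v → c * a + v) (span bs)) 𝔽q) x∈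
  ... | ys , x∈ys , ys∈ with ∈-map⁻ (λ c → map (λ v → c * a + v) (span bs)) ys∈
  ... | c , c∈ , refl with ∈-map⁻ (λ v → c * a + v) x∈ys
  ... | v , v∈ , x≡ = c , v , ∈𝔽q⁻ c∈ , v∈ , x≡

  0∈span : ∀ bs → 0# ∈ span bs
  0∈span []       = here refl
  0∈span (a ∷ bs) = subst (_∈ span (a ∷ bs)) (0*a+v≡v a 0#) (∈-span-∷⁺ a bs InFq-0 (0∈span bs))

  span-+ : ∀ bs {x y} → x ∈ span bs → y ∈ span bs → x + y ∈ span bs
  span-+ []       (here refl) (here refl) = here (+-identityʳ 0#)
  span-+ (a ∷ bs) x∈ y∈ with ∈-span-∷⁻ a bs x∈ | ∈-span-∷⁻ a bs y∈
  ... | c , v , cᵠ≡c , v∈ , refl | c′ , v′ , c′ᵠ≡c′ , v′∈ , refl =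
    subst (_∈ span (a ∷ bs))
          (solve 5 (λ c c′ a v v′ → (c :+ c′) :* a :+ (v :+ v′) := (c :* a :+ v) :+ (c′ :* a :+ v′)) refl c c′ a v v′)
      (∈-span-∷⁺ a bs (InFq-+ cᵠ≡c c′ᵠ≡c′) (span-+ bs v∈ v′∈))

  span-* : ∀ bs {k x} → InFq k → x ∈ span bs → k * x ∈ span bs
  span-* []       kᵠ≡k (here refl) = here (zeroʳ _)
  span-* (a ∷ bs) {k} kᵠ≡k x∈ with ∈-span-∷⁻ a bs x∈
  ... | c , v , cᵠ≡c , v∈ , refl =
    subst (_∈ span (a ∷ bs)) (solve 4 (λ k c a v → (k :* c) :* a :+ k :* v := k :* (c :* a :+ v)) refl k c a v)
      (∈-span-∷⁺ a bs (InFq-* kᵠ≡k cᵠ≡c) (span-* bs kᵠ≡k v∈))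

  span-sub : ∀ bs {x y} → x ∈ span bs → y ∈ span bs → x - y ∈ span bs
  span-sub bs x∈ y∈ = span-+ bs x∈ (subst (_∈ span bs) (-1*x≈-x _) (span-* bs (InFq-neg InFq-1) y∈))

  ∈-span-head : ∀ a bs → a ∈ span (a ∷ bs)
  ∈-span-head a bs = subst (_∈ span (a ∷ bs)) (solve 1 (λ a → 𝟙 :* a :+ 𝟘 := a) refl a)
                           (∈-span-∷⁺ a bs InFq-1 (0∈span bs))

  span⊆span-∷ : ∀ a bs {x} → x ∈ span bs → x ∈ span (a ∷ bs)
  span⊆span-∷ a bs {x} x∈ = subst (_∈ span (a ∷ bs)) (0*a+v≡v a x) (∈-span-∷⁺ a bs InFq-0 x∈)

  ∈-span : ∀ bs {b} → b ∈ bs → b ∈ span bs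
  ∈-span (b ∷ bs) (here refl) = ∈-span-head b bs
  ∈-span (c ∷ bs) (there b∈)  = span⊆span-∷ c bs (∈-span bs b∈)

  Independent : List Carrier → Set
  Independent []       = ⊤
  Independent (a ∷ bs) = a ∉ span bs × Independent bs

  ∉span-shift : ∀ a bs {c v} → a ∉ span bs → InFq c → c ≢ 0# → v ∈ span bs → c * a + v ∉ span bs
  ∉span-shift a bs {c} {v} a∉ cᵠ≡c c≢0 v∈ ca+v∈ =
    a∉ (subst (_∈ span bs) c⁻¹[ca+v-v]≡a (span-* bs (InFq-⁻¹ cᵠ≡c c≢0) (span-sub bs ca+v∈ v∈)))
    where
    c⁻¹[ca+v-v]≡a : c ⁻¹ * ((c * a + v) - v) ≡ a
    c⁻¹[ca+v-v]≡a = begin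
      c ⁻¹ * ((c * a + v) - v)
        ≡⟨ solve 4 (λ i c a v → i :* ((c :* a :+ v) :- v) := (i :* c) :* a) refl (c ⁻¹) c a v ⟩
      (c ⁻¹ * c) * a
        ≡⟨ cong (_* a) (inverseˡ c c≢0) ⟩
      1# * a
        ≡⟨ *-identityˡ a ⟩
      a ∎

  span-∷-coefficient-unique : ∀ a bs {c c′ v v′} → a ∉ span bs → InFq c → InFq c′ →
                              v ∈ span bs → v′ ∈ span bs → c * a + v ≡ c′ * a + v′ → c ≡ c′
  span-∷-coefficient-unique a bs {c} {c′} {v} {v′} a∉ cᵠ≡c c′ᵠ≡c′ v∈ v′∈ eq with c ≟ c′
  ... | yes c≡c′ = c≡c′
  ... | no  c≢c′ = ⊥-elim (a∉ (subst (_∈ span bs) d⁻¹[v′-v]≡a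
                     (span-* bs (InFq-⁻¹ (InFq-sub cᵠ≡c c′ᵠ≡c′) d≢0) (span-sub bs v′∈ v∈))))
    where
    d = c - c′
    d≢0 : d ≢ 0#
    d≢0 = c≢c′ ∘ x-y≡0⇒x≡y
    d⁻¹[v′-v]≡a : d ⁻¹ * (v′ - v) ≡ a
    d⁻¹[v′-v]≡a = begin
      d ⁻¹ * (v′ - v)
        ≡⟨ cong (d ⁻¹ *_) (solve 5 (λ c c′ a v v′ → v′ :- v := (c :- c′) :* a :- ((c :* a :+ v) :- (c′ :* a :+ v′)))
                                   refl c c′ a v v′) ⟩
      d ⁻¹ * (d * a - ((c * a + v) - (c′ * a + v′)))
        ≡⟨ cong (λ t → d ⁻¹ * (d * a - (t - (c′ * a + v′)))) eq ⟩
      d ⁻¹ * (d * a - ((c′ * a + v′) - (c′ * a + v′)))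
        ≡⟨ cong (λ t → d ⁻¹ * (d * a - t)) (-‿inverseʳ _) ⟩
      d ⁻¹ * (d * a - 0#)
        ≡⟨ solve 3 (λ i d a → i :* (d :* a :- 𝟘) := (i :* d) :* a) refl (d ⁻¹) d a ⟩
      (d ⁻¹ * d) * a
        ≡⟨ cong (_* a) (inverseˡ d d≢0) ⟩
      1# * a
        ≡⟨ *-identityˡ a ⟩
      a ∎

  span-unique : ∀ bs → Independent bs → Unique (span bs)
  span-unique []       _          = [] ∷ []
  span-unique (a ∷ bs) (a∉ , ind) =
    Unique.concat⁺ (All.map⁺ (All.tabulate (λ {c} _ → Unique.map⁺ (+-cancelˡ (c * a) _ _) (span-unique bs ind))))
                   (AllPairs.map⁺ (AllPairs.map disjoint (distinct 𝔽q 𝔽q-unique ∈𝔽q⁻)))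
    where
    distinct : ∀ cs → Unique cs → (∀ {c} → c ∈ cs → InFq c) →
               AllPairs (λ c c′ → c ≢ c′ × InFq c × InFq c′) cs
    distinct []       _           _    = []
    distinct (c ∷ cs) (c∉ ∷ ucs) inFq =
      All.tabulate (λ c′∈ → All.lookup c∉ c′∈ , inFq (here refl) , inFq (there c′∈)) ∷ distinct cs ucs (inFq ∘ there)
    disjoint : ∀ {c c′} → c ≢ c′ × InFq c × InFq c′ →
               Disjoint (map (λ v → c * a + v) (span bs)) (map (λ v → c′ * a + v) (span bs))
    disjoint {c} {c′} (c≢c′ , cᵠ≡c , c′ᵠ≡c′) (x∈₁ , x∈₂)
      with ∈-map⁻ (λ v → c * a + v) x∈₁ | ∈-map⁻ (λ v → c′ * a + v) x∈₂
    ... | v , v∈ , refl | v′ , v′∈ , eq = c≢c′ (span-∷-coefficient-unique a bs a∉ cᵠ≡c c′ᵠ≡c′ v∈ v′∈ eq)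

  length-span : ∀ bs → length (span bs) ≡ q ℕ.^ length bs
  length-span []       = refl
  length-span (a ∷ bs) = ≡-trans (length-concatMap 𝔽q) (cong₂ ℕ._*_ length-𝔽q (length-span bs))
    where
    length-concatMap : ∀ cs → length (concatMap (λ c → map (λ v → c * a + v) (span bs)) cs) ≡ length cs ℕ.* length (span bs)
    length-concatMap []       = refl
    length-concatMap (c ∷ cs) = ≡-trans (List.length-++ (map (λ v → c * a + v) (span bs)))
                                        (cong₂ ℕ._+_ (List.length-map _ (span bs)) (length-concatMap cs))

  L[_] : List Carrier → Carrier → Carrier
  L[ bs ] x = prodL (span bs) (λ u → x - u)

  L-[] : ∀ x → L[ [] ] x ≡ x
  L-[] = solve 1 (λ x → (x :- 𝟘) :* 𝟙 := x) refl

  fold-span-∷ : ∀ {_∙_ ε} (isCM : IsCommutativeMonoid _≡_ _∙_ ε) a bs (f : Carrier → Carrier) →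
                FoldProperties.fold isCM (span (a ∷ bs)) f ≡
                FoldProperties.fold isCM 𝔽q (λ c → FoldProperties.fold isCM (span bs) (λ v → f (c * a + v)))
  fold-span-∷ isCM a bs f = ≡-trans (fold-concatMap (λ c → map (λ v → c * a + v) (span bs)) 𝔽q f)
                                    (fold-ext 𝔽q (λ c → fold-map (λ v → c * a + v) (span bs) f))
    where open FoldProperties isCM

  L-∷ : ∀ a bs x → L[ a ∷ bs ] x ≡ prodL 𝔽q (λ c → L[ bs ] (x - c * a))
  L-∷ a bs x = ≡-trans (fold-span-∷ *-isCommutativeMonoid a bs (λ u → x - u))
    (∏.fold-ext 𝔽q (λ c → ∏.fold-ext (span bs) (λ v →
      solve 4 (λ x c a v → x :- (c :* a :+ v) := (x :- c :* a) :- v) refl x c a v)))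

  -- L[ bs ] is 𝔽q-linear; linearity and the recursion for L[ a ∷ bs ] are proved together.
  mutual
    L-+ : ∀ bs x y → L[ bs ] (x + y) ≡ L[ bs ] x + L[ bs ] y
    L-+ []       x y = solve 2 (λ x y → ((x :+ y) :- 𝟘) :* 𝟙 := (x :- 𝟘) :* 𝟙 :+ (y :- 𝟘) :* 𝟙) refl x y
    L-+ (a ∷ bs) x y = begin
      L[ a ∷ bs ] (x + y)
        ≡⟨ L-∷-frobenius a bs (x + y) ⟩
      L[ bs ] (x + y) ^ q - B * L[ bs ] (x + y)
        ≡⟨ cong (λ t → t ^ q - B * t) (L-+ bs x y) ⟩
      (X + Y) ^ q - B * (X + Y)
        ≡⟨ cong (_- B * (X + Y)) (frobenius-q X Y) ⟩
      (X ^ q + Y ^ q) - B * (X + Y)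
        ≡⟨ solve 5 (λ P Q B X Y → (P :+ Q) :- B :* (X :+ Y) := (P :- B :* X) :+ (Q :- B :* Y)) refl (X ^ q) (Y ^ q) B X Y ⟩
      (X ^ q - B * X) + (Y ^ q - B * Y)
        ≡⟨ sym (cong₂ _+_ (L-∷-frobenius a bs x) (L-∷-frobenius a bs y)) ⟩
      L[ a ∷ bs ] x + L[ a ∷ bs ] y ∎
      where
      X = L[ bs ] x
      Y = L[ bs ] y
      B = L[ bs ] a ^ q-1

    L-* : ∀ bs {c} → InFq c → ∀ x → L[ bs ] (c * x) ≡ c * L[ bs ] x
    L-* []       {c} _     x = solve 2 (λ c x → ((c :* x) :- 𝟘) :* 𝟙 := c :* ((x :- 𝟘) :* 𝟙)) refl c x
    L-* (a ∷ bs) {c} cᵠ≡c x = begin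
      L[ a ∷ bs ] (c * x)
        ≡⟨ L-∷-frobenius a bs (c * x) ⟩
      L[ bs ] (c * x) ^ q - B * L[ bs ] (c * x)
        ≡⟨ cong (λ t → t ^ q - B * t) (L-* bs cᵠ≡c x) ⟩
      (c * X) ^ q - B * (c * X)
        ≡⟨ cong (_- B * (c * X)) (≡-trans (^-distribʳ-* c X q) (cong (_* X ^ q) cᵠ≡c)) ⟩
      c * X ^ q - B * (c * X)
        ≡⟨ solve 4 (λ c P B X → c :* P :- B :* (c :* X) := c :* (P :- B :* X)) refl c (X ^ q) B X ⟩
      c * (X ^ q - B * X)
        ≡⟨ cong (c *_) (sym (L-∷-frobenius a bs x)) ⟩
      c * L[ a ∷ bs ] x ∎
      where
      X = L[ bs ] x
      B = L[ bs ] a ^ q-1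

    L-∷-frobenius : ∀ a bs x → L[ a ∷ bs ] x ≡ L[ bs ] x ^ q - L[ bs ] a ^ q-1 * L[ bs ] x
    L-∷-frobenius a bs x = begin
      L[ a ∷ bs ] x                            ≡⟨ L-∷ a bs x ⟩
      prodL 𝔽q (λ c → L[ bs ] (x - c * a))     ≡⟨ ∏.fold-cong 𝔽q (λ c∈ → L-x-ca (∈𝔽q⁻ c∈)) ⟩
      prodL 𝔽q (λ c → L[ bs ] x - c * L[ bs ] a) ≡⟨ prod-𝔽q-multiples (L[ bs ] x) (L[ bs ] a) ⟩
      L[ bs ] x ^ q - L[ bs ] a ^ q-1 * L[ bs ] x ∎
      where
      L-x-ca : ∀ {c} → InFq c → L[ bs ] (x - c * a) ≡ L[ bs ] x - c * L[ bs ] a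
      L-x-ca {c} cᵠ≡c = begin
        L[ bs ] (x - c * a)
          ≡⟨ cong L[ bs ] (solve 3 (λ x c a → x :- c :* a := x :+ (:- c) :* a) refl x c a) ⟩
        L[ bs ] (x + (- c) * a)
          ≡⟨ L-+ bs x ((- c) * a) ⟩
        L[ bs ] x + L[ bs ] ((- c) * a)
          ≡⟨ cong (L[ bs ] x +_) (L-* bs (InFq-neg cᵠ≡c) a) ⟩
        L[ bs ] x + (- c) * L[ bs ] a
          ≡⟨ solve 3 (λ X c A → X :+ (:- c) :* A := X :- c :* A) refl (L[ bs ] x) c (L[ bs ] a) ⟩
        L[ bs ] x - c * L[ bs ] a ∎

  L-sub : ∀ bs x y → L[ bs ] (x - y) ≡ L[ bs ] x - L[ bs ] y
  L-sub bs x y = begin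
    L[ bs ] (x - y)
      ≡⟨ L-+ bs x (- y) ⟩
    L[ bs ] x + L[ bs ] (- y)
      ≡⟨ cong (λ t → L[ bs ] x + L[ bs ] t) (sym (-1*x≈-x y)) ⟩
    L[ bs ] x + L[ bs ] (- 1# * y)
      ≡⟨ cong (L[ bs ] x +_) (≡-trans (L-* bs (InFq-neg InFq-1) y) (-1*x≈-x _)) ⟩
    L[ bs ] x - L[ bs ] y ∎

  L≡0⁺ : ∀ bs {x} → x ∈ span bs → L[ bs ] x ≡ 0#
  L≡0⁺ bs {x} x∈ = prod≡0 (span bs) (λ u → x - u) x∈ (-‿inverseʳ x)

  L≡0⁻ : ∀ bs {x} → L[ bs ] x ≡ 0# → x ∈ span bs
  L≡0⁻ bs {x} Lx≡0 with prod≡0⇒∃f≡0 (span bs) (λ u → x - u) Lx≡0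
  ... | u , u∈ , x-u≡0 = subst (_∈ span bs) (sym (x-y≡0⇒x≡y x-u≡0)) u∈

  L-≢0 : ∀ bs {x} → x ∉ span bs → L[ bs ] x ≢ 0#
  L-≢0 bs x∉ Lx≡0 = x∉ (L≡0⁻ bs Lx≡0)

  negOr1 : Carrier → Carrier
  negOr1 u with u ≟ 0#
  ... | yes _ = 1#
  ... | no  _ = - u

  negOr1-≢0 : ∀ {u} → u ≢ 0# → negOr1 u ≡ - u
  negOr1-≢0 {u} u≢0 with u ≟ 0#
  ... | yes u≡0 = ⊥-elim (u≢0 u≡0)
  ... | no  _   = refl

  negOr1-0 : negOr1 0# ≡ 1#
  negOr1-0 with 0# ≟ 0#
  ... | yes _   = refl
  ... | no  0≢0 = ⊥-elim (0≢0 refl)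

  negOr1-nonzero : ∀ u → negOr1 u ≢ 0#
  negOr1-nonzero u with u ≟ 0#
  ... | yes _   = 1≢0
  ... | no  u≢0 = λ -u≡0 → u≢0 (≡-trans (sym (-‿involutive u)) (≡-trans (cong -_ -u≡0) -0#≈0#))

  -- The coefficient of x in L[ bs ] x, namely ∏ (- u) over the nonzero u in span bs.
  linCoeff : List Carrier → Carrier
  linCoeff bs = prodL (span bs) negOr1

  linCoeff-≢0 : ∀ bs → linCoeff bs ≢ 0#
  linCoeff-≢0 bs = prod-≢0 (span bs) negOr1 (λ {u} _ → negOr1-nonzero u)

  linCoeff-[] : linCoeff [] ≡ 1#
  linCoeff-[] = ≡-trans (cong (_* 1#) negOr1-0) (*-identityˡ 1#)

  linCoeff-∷ : ∀ a bs → Independent (a ∷ bs) → linCoeff (a ∷ bs) ≡ - (L[ bs ] a ^ q-1) * linCoeff bs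
  linCoeff-∷ a bs (a∉ , _) = begin
    linCoeff (a ∷ bs)
      ≡⟨ fold-span-∷ *-isCommutativeMonoid a bs negOr1 ⟩
    prodL (span bs) (λ v → negOr1 (0# * a + v)) * prodL 𝔽q* (λ c → prodL (span bs) (λ v → negOr1 (c * a + v)))
      ≡⟨ cong₂ _*_ (∏.fold-ext (span bs) (λ v → cong negOr1 (0*a+v≡v a v))) (∏.fold-cong 𝔽q* block) ⟩
    linCoeff bs * prodL 𝔽q* (λ c → (- c) * β)
      ≡⟨ cong (linCoeff bs *_) (∏.fold-distrib 𝔽q* (λ c → - c) (λ _ → β)) ⟩
    linCoeff bs * (prodL 𝔽q* (λ c → - c) * prodL 𝔽q* (λ _ → β))
      ≡⟨ cong₂ (λ s t → linCoeff bs * (s * t)) wilson (≡-trans (prod-const 𝔽q* β) (cong (β ^_) length-𝔽q*)) ⟩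
    linCoeff bs * (- 1# * β ^ q-1)
      ≡⟨ solve 2 (λ A B → A :* (:- 𝟙 :* B) := (:- B) :* A) refl (linCoeff bs) (β ^ q-1) ⟩
    - (β ^ q-1) * linCoeff bs ∎
    where
    β = L[ bs ] a
    block : ∀ {c} → c ∈ 𝔽q* → prodL (span bs) (λ v → negOr1 (c * a + v)) ≡ (- c) * β
    block {c} c∈ = begin
      prodL (span bs) (λ v → negOr1 (c * a + v))
        ≡⟨ ∏.fold-cong (span bs) (λ {v} v∈ → ≡-trans (negOr1-≢0 (ca+v≢0 v∈))
                                   (solve 3 (λ c a v → :- (c :* a :+ v) := (:- c) :* a :- v) refl c a v)) ⟩
      L[ bs ] ((- c) * a)                          ≡⟨ L-* bs (InFq-neg (proj₁ (∈𝔽q*⁻ c∈))) a ⟩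
      (- c) * β                                    ∎
      where
      ca+v≢0 : ∀ {v} → v ∈ span bs → c * a + v ≢ 0#
      ca+v≢0 v∈ ca+v≡0 = ∉span-shift a bs a∉ (proj₁ (∈𝔽q*⁻ c∈)) (proj₂ (∈𝔽q*⁻ c∈)) v∈
                           (subst (_∈ span bs) (sym ca+v≡0) (0∈span bs))

  cosetSum : List Carrier → Carrier → Carrier
  cosetSum bs x = sumL (span bs) (λ v → g (x + v))

  spanSum : List Carrier → Carrier
  spanSum bs = sumL (span bs) g

  cosetSum-∷ : ∀ a bs x → cosetSum (a ∷ bs) x ≡ sumL 𝔽q (λ c → cosetSum bs (x + c * a))
  cosetSum-∷ a bs x = ≡-trans (fold-span-∷ +-isCommutativeMonoid a bs (λ v → g (x + v)))
    (∑.fold-ext 𝔽q (λ c → ∑.fold-ext (span bs) (λ v → cong g (sym (+-assoc x (c * a) v)))))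

  -- With β = L[ bs ] a and z = L[ bs ] x / β, one has L[ a ∷ bs ] x = β^q (z^q - z)
  -- and linCoeff (a ∷ bs) = - β^(q-1) linCoeff bs.
  L-∷/linCoeff : ∀ a bs → Independent (a ∷ bs) → ∀ x →
    let β = L[ bs ] a ; z = L[ bs ] x * β ⁻¹ in
    L[ a ∷ bs ] x * linCoeff (a ∷ bs) ⁻¹ ≡ - ((z ^ q - z) * (β * linCoeff bs ⁻¹))
  L-∷/linCoeff a bs ind@(a∉ , _) x = begin
    L[ a ∷ bs ] x * A′ ⁻¹          ≡⟨ cong (_* A′ ⁻¹) L′≡ ⟩
    (Y * A′) * A′ ⁻¹               ≡⟨ solve 3 (λ Y A I → (Y :* A) :* I := Y :* (A :* I)) refl Y A′ (A′ ⁻¹) ⟩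
    Y * (A′ * A′ ⁻¹)               ≡⟨ cong (Y *_) (inverseʳ A′ (linCoeff-≢0 (a ∷ bs))) ⟩
    Y * 1#                         ≡⟨ *-identityʳ Y ⟩
    Y                              ∎
    where
    A = linCoeff bs
    A′ = linCoeff (a ∷ bs)
    β = L[ bs ] a
    y = L[ bs ] x
    z = y * β ⁻¹
    W = z ^ q - z
    B = β ^ q-1
    Y = - (W * (β * A ⁻¹))
    zβ≡y : z * β ≡ y
    zβ≡y = x*y⁻¹*y≡x y (L-≢0 bs a∉)
    L′≡ : L[ a ∷ bs ] x ≡ Y * A′
    L′≡ = begin
      L[ a ∷ bs ] x
        ≡⟨ L-∷-frobenius a bs x ⟩
      y ^ q - B * y
        ≡⟨ cong (λ t → t ^ q - B * t) (sym zβ≡y) ⟩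
      (z * β) ^ q - B * (z * β)
        ≡⟨ cong (_- B * (z * β)) (≡-trans (^-distribʳ-* z β q) (cong (z ^ q *_) (x^q≡x*x^q-1 β))) ⟩
      z ^ q * (β * B) - B * (z * β)
        ≡⟨ solve 4 (λ Z z b B → Z :* (b :* B) :- B :* (z :* b) := ((Z :- z) :* b :* B) :* 𝟙) refl (z ^ q) z β B ⟩
      (W * β * B) * 1#
        ≡⟨ cong ((W * β * B) *_) (sym (inverseˡ A (linCoeff-≢0 bs))) ⟩
      (W * β * B) * (A ⁻¹ * A)
        ≡⟨ solve 5 (λ W b B i a → (W :* b :* B) :* (i :* a) := (:- (W :* (b :* i))) :* ((:- B) :* a)) refl W β B (A ⁻¹) A ⟩
      Y * (- B * A)
        ≡⟨ cong (Y *_) (sym (linCoeff-∷ a bs ind)) ⟩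
      Y * A′ ∎

  L-ratio-∉𝔽q : ∀ a bs → a ∉ span bs → ∀ {x} → x ∉ span (a ∷ bs) → ¬ InFq (L[ bs ] x * L[ bs ] a ⁻¹)
  L-ratio-∉𝔽q a bs a∉ {x} x∉ zᵠ≡z =
    x∉ (subst (_∈ span (a ∷ bs)) (solve 3 (λ z a x → z :* a :+ (x :- z :* a) := x) refl z a x)
              (∈-span-∷⁺ a bs zᵠ≡z (L≡0⁻ bs L[x-za]≡0)))
    where
    y = L[ bs ] x
    z = y * L[ bs ] a ⁻¹
    L[x-za]≡0 : L[ bs ] (x - z * a) ≡ 0#
    L[x-za]≡0 = begin
      L[ bs ] (x - z * a)         ≡⟨ L-sub bs x (z * a) ⟩
      y - L[ bs ] (z * a)         ≡⟨ cong (λ t → y - t) (≡-trans (L-* bs zᵠ≡z a) (x*y⁻¹*y≡x y (L-≢0 bs a∉))) ⟩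
      y - y                       ≡⟨ -‿inverseʳ y ⟩
      0#                          ∎

  ∉span-∷-shift : ∀ a bs {x c} → x ∉ span (a ∷ bs) → InFq c → x + c * a ∉ span bs
  ∉span-∷-shift a bs {x} {c} x∉ cᵠ≡c x+ca∈ =
    x∉ (subst (_∈ span (a ∷ bs)) (solve 3 (λ c a x → (:- c) :* a :+ (x :+ c :* a) := x) refl c a x)
              (∈-span-∷⁺ a bs (InFq-neg cᵠ≡c) x+ca∈))

  -- The sum over x + span (a ∷ bs) splits into the sums over x + c a + span bs, c ∈ 𝔽q, which sum-g-coset adds up.
  cosetSum≡invPow : ∀ bs → Independent bs → ∀ x → x ∉ span bs →
                    cosetSum bs x ≡ invPow (L[ bs ] x * linCoeff bs ⁻¹)
  cosetSum≡invPow [] _ x x∉ = begin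
    g (x + 0#) + 0#
      ≡⟨ ≡-trans (+-identityʳ _) (cong g (+-identityʳ x)) ⟩
    g x
      ≡⟨ g≡invPow (x∉ ∘ here) ⟩
    invPow x
      ≡⟨ cong invPow (solve 1 (λ x → x := ((x :- 𝟘) :* 𝟙) :* 𝟙) refl x) ⟩
    invPow (L[ [] ] x * 1#)
      ≡⟨ cong (λ t → invPow (L[ [] ] x * t)) (sym (≡-trans (cong _⁻¹ linCoeff-[]) 1⁻¹≡1)) ⟩
    invPow (L[ [] ] x * linCoeff [] ⁻¹) ∎
  cosetSum≡invPow (a ∷ bs) ind@(a∉ , ind′) x x∉ = begin
    cosetSum (a ∷ bs) x                           ≡⟨ cosetSum-∷ a bs x ⟩
    sumL 𝔽q (λ c → cosetSum bs (x + c * a))       ≡⟨ ∑.fold-cong 𝔽q (λ c∈ → term (∈𝔽q⁻ c∈)) ⟩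
    sumL 𝔽q (λ c → g (z + c) * K′)                ≡⟨ sum-distribʳ 𝔽q K′ (λ c → g (z + c)) ⟩
    sumL 𝔽q (λ c → g (z + c)) * K′                ≡⟨ cong (_* K′) (sum-g-coset z z∉𝔽q) ⟩
    invPow W * K′                                 ≡⟨ sym (invPow-* W≢0 βA⁻¹≢0) ⟩
    invPow (W * (β * A ⁻¹))                       ≡⟨ sym (invPow-neg (*-≢0 W≢0 βA⁻¹≢0)) ⟩
    invPow (- (W * (β * A ⁻¹)))                   ≡⟨ cong invPow (sym (L-∷/linCoeff a bs ind x)) ⟩
    invPow (L[ a ∷ bs ] x * linCoeff (a ∷ bs) ⁻¹) ∎
    where
    A = linCoeff bs
    β = L[ bs ] a
    z = L[ bs ] x * β ⁻¹
    W = z ^ q - z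
    K′ = invPow (β * A ⁻¹)
    βA⁻¹≢0 : β * A ⁻¹ ≢ 0#
    βA⁻¹≢0 = *-≢0 (L-≢0 bs a∉) (⁻¹-≢0 (linCoeff-≢0 bs))
    z∉𝔽q : ¬ InFq z
    z∉𝔽q = L-ratio-∉𝔽q a bs a∉ x∉
    W≢0 : W ≢ 0#
    W≢0 = ¬InFq⇒x^q-x≢0 z∉𝔽q
    term : ∀ {c} → InFq c → cosetSum bs (x + c * a) ≡ g (z + c) * K′
    term {c} cᵠ≡c = begin
      cosetSum bs (x + c * a)
        ≡⟨ cosetSum≡invPow bs ind′ (x + c * a) (∉span-∷-shift a bs x∉ cᵠ≡c) ⟩
      invPow (L[ bs ] (x + c * a) * A ⁻¹)
        ≡⟨ cong (λ t → invPow (t * A ⁻¹)) (L-+ bs x (c * a)) ⟩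
      invPow ((L[ bs ] x + L[ bs ] (c * a)) * A ⁻¹)
        ≡⟨ cong₂ (λ s t → invPow ((s + t) * A ⁻¹)) (sym (x*y⁻¹*y≡x (L[ bs ] x) (L-≢0 bs a∉))) (L-* bs cᵠ≡c a) ⟩
      invPow ((z * β + c * β) * A ⁻¹)
        ≡⟨ cong invPow (solve 4 (λ z b c i → (z :* b :+ c :* b) :* i := (z :+ c) :* (b :* i)) refl z β c (A ⁻¹)) ⟩
      invPow ((z + c) * (β * A ⁻¹))
        ≡⟨ invPow-* z+c≢0 βA⁻¹≢0 ⟩
      invPow (z + c) * K′
        ≡⟨ cong (_* K′) (sym (g≡invPow z+c≢0)) ⟩
      g (z + c) * K′ ∎
      where
      z+c≢0 : z + c ≢ 0#
      z+c≢0 = ¬InFq-shift-≢0 z∉𝔽q cᵠ≡c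

  spanSum-[] : spanSum [] ≡ 0#
  spanSum-[] = ≡-trans (+-identityʳ _) g-0

  spanSum-∷ : ∀ a bs → Independent (a ∷ bs) → spanSum (a ∷ bs) ≡ spanSum bs - invPow (L[ bs ] a * linCoeff bs ⁻¹)
  spanSum-∷ a bs (a∉ , ind) = begin
    spanSum (a ∷ bs)
      ≡⟨ fold-span-∷ +-isCommutativeMonoid a bs g ⟩
    sumL (span bs) (λ v → g (0# * a + v)) + sumL 𝔽q* (λ c → cosetSum bs (c * a))
      ≡⟨ cong₂ _+_ (∑.fold-ext (span bs) (λ v → cong g (0*a+v≡v a v))) (∑.fold-cong 𝔽q* term) ⟩
    spanSum bs + sumL 𝔽q* (λ _ → K′)
      ≡⟨ cong (spanSum bs +_) (sum-const 𝔽q* K′) ⟩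
    spanSum bs + ⟦ length 𝔽q* ⟧ℕ * K′
      ≡⟨ cong (λ k → spanSum bs + ⟦ k ⟧ℕ * K′) length-𝔽q* ⟩
    spanSum bs + ⟦ q-1 ⟧ℕ * K′
      ≡⟨ cong (λ t → spanSum bs + t * K′) ⟦q-1⟧≡-1 ⟩
    spanSum bs + - 1# * K′
      ≡⟨ cong (spanSum bs +_) (-1*x≈-x K′) ⟩
    spanSum bs - K′ ∎
    where
    A = linCoeff bs
    β = L[ bs ] a
    K′ = invPow (β * A ⁻¹)
    βA⁻¹≢0 : β * A ⁻¹ ≢ 0#
    βA⁻¹≢0 = *-≢0 (L-≢0 bs a∉) (⁻¹-≢0 (linCoeff-≢0 bs))
    term : ∀ {c} → c ∈ 𝔽q* → cosetSum bs (c * a) ≡ K′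
    term {c} c∈ = begin
      cosetSum bs (c * a)             ≡⟨ cosetSum≡invPow bs ind (c * a) ca∉ ⟩
      invPow (L[ bs ] (c * a) * A ⁻¹) ≡⟨ cong (λ t → invPow (t * A ⁻¹)) (L-* bs cᵠ≡c a) ⟩
      invPow ((c * β) * A ⁻¹)         ≡⟨ cong invPow (*-assoc c β (A ⁻¹)) ⟩
      invPow (c * (β * A ⁻¹))         ≡⟨ invPow-* c≢0 βA⁻¹≢0 ⟩
      invPow c * K′                   ≡⟨ cong (_* K′) (invPow-InFq cᵠ≡c c≢0) ⟩
      1# * K′                         ≡⟨ *-identityˡ K′ ⟩
      K′                              ∎
      where
      cᵠ≡c : InFq c
      cᵠ≡c = proj₁ (∈𝔽q*⁻ c∈)
      c≢0 : c ≢ 0#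
      c≢0 = proj₂ (∈𝔽q*⁻ c∈)
      ca∉ : c * a ∉ span bs
      ca∉ ca∈ = ∉span-shift a bs a∉ cᵠ≡c c≢0 (0∈span bs) (subst (_∈ span bs) (sym (+-identityʳ _)) ca∈)

  record Composition (ts es : List Carrier) : Set where
    field
      L-∘             : ∀ x → L[ ts ++ es ] x ≡ L[ map L[ es ] ts ] (L[ es ] x)
      linCoeff-*      : linCoeff (ts ++ es) ≡ linCoeff es * linCoeff (map L[ es ] ts)
      spanSum-++      : spanSum (ts ++ es) ≡ spanSum es + invPow (linCoeff es ⁻¹) * spanSum (map L[ es ] ts)
      image-independent : Independent (map L[ es ] ts)

  spanSum-∷-++ : ∀ t ts es → Independent (t ∷ ts ++ es) → Composition ts es →
                 Independent (L[ es ] t ∷ map L[ es ] ts) →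
                 spanSum (t ∷ ts ++ es) ≡ spanSum es + invPow (linCoeff es ⁻¹) * spanSum (L[ es ] t ∷ map L[ es ] ts)
  spanSum-∷-++ t ts es (t∉ , ind) ih ind-t′G = begin
    spanSum (t ∷ W)
      ≡⟨ spanSum-∷ t W (t∉ , ind) ⟩
    spanSum W - invPow (β * linCoeff W ⁻¹)
      ≡⟨ cong₂ (λ a b → a - invPow (β * b ⁻¹)) spanSum-++ linCoeff-* ⟩
    S - invPow (β * (Aₑ * A) ⁻¹)
      ≡⟨ cong (λ u → S - invPow (β * u)) (⁻¹-distrib-* (linCoeff-≢0 es) (linCoeff-≢0 G)) ⟩
    S - invPow (β * (Aₑ ⁻¹ * A ⁻¹))
      ≡⟨ cong (λ u → S - invPow u) (solve 3 (λ b a c → b :* (a :* c) := (b :* c) :* a) refl β (Aₑ ⁻¹) (A ⁻¹)) ⟩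
    S - invPow ((β * A ⁻¹) * Aₑ ⁻¹)
      ≡⟨ cong (λ u → S - u) (invPow-* (*-≢0 (L-≢0 W t∉) (⁻¹-≢0 (linCoeff-≢0 G))) (⁻¹-≢0 (linCoeff-≢0 es))) ⟩
    S - invPow (β * A ⁻¹) * κ
      ≡⟨ solve 4 (λ S k T I → (S :+ k :* T) :- I :* k := S :+ k :* (T :- I))
                 refl (spanSum es) κ (spanSum G) (invPow (β * A ⁻¹)) ⟩
    spanSum es + κ * (spanSum G - invPow (β * A ⁻¹))
      ≡⟨ cong (λ u → spanSum es + κ * (spanSum G - invPow (u * A ⁻¹))) (L-∘ t) ⟩
    spanSum es + κ * (spanSum G - invPow (L[ G ] (L[ es ] t) * A ⁻¹))
      ≡⟨ cong (λ u → spanSum es + κ * u) (sym (spanSum-∷ (L[ es ] t) G ind-t′G)) ⟩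
    spanSum es + κ * spanSum (L[ es ] t ∷ G) ∎
    where
    open Composition ih using (L-∘; linCoeff-*; spanSum-++)
    W = ts ++ es
    G = map L[ es ] ts
    β = L[ W ] t
    Aₑ = linCoeff es
    A = linCoeff G
    κ = invPow (Aₑ ⁻¹)
    S = spanSum es + κ * spanSum G

  composition-∷ : ∀ t ts es → Independent (t ∷ ts ++ es) → Composition ts es → Composition (t ∷ ts) es
  composition-∷ t ts es ind@(t∉ , ind′) ih = record
    { L-∘               = L-∘′
    ; linCoeff-*        = linCoeff-*′
    ; spanSum-++        = spanSum-∷-++ t ts es ind ih (t′∉ , G-independent)
    ; image-independent = t′∉ , G-independent
    }
    where
    W = ts ++ es
    G = map L[ es ] ts
    t′ = L[ es ] t
    open Composition ih renaming (image-independent to G-independent)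
    β = L[ W ] t
    L[G]t′≡β : L[ G ] t′ ≡ β
    L[G]t′≡β = sym (L-∘ t)
    t′∉ : t′ ∉ span G
    t′∉ t′∈ = L-≢0 W t∉ (≡-trans (L-∘ t) (L≡0⁺ G t′∈))
    L-∘′ : ∀ x → L[ t ∷ W ] x ≡ L[ t′ ∷ G ] (L[ es ] x)
    L-∘′ x = begin
      L[ t ∷ W ] x
        ≡⟨ L-∷-frobenius t W x ⟩
      L[ W ] x ^ q - β ^ q-1 * L[ W ] x
        ≡⟨ cong₂ (λ u v → u ^ q - v ^ q-1 * u) (L-∘ x) (sym L[G]t′≡β) ⟩
      L[ G ] (L[ es ] x) ^ q - L[ G ] t′ ^ q-1 * L[ G ] (L[ es ] x)
        ≡⟨ sym (L-∷-frobenius t′ G (L[ es ] x)) ⟩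
      L[ t′ ∷ G ] (L[ es ] x) ∎
    linCoeff-*′ : linCoeff (t ∷ W) ≡ linCoeff es * linCoeff (t′ ∷ G)
    linCoeff-*′ = begin
      linCoeff (t ∷ W)
        ≡⟨ linCoeff-∷ t W ind ⟩
      - (β ^ q-1) * linCoeff W
        ≡⟨ cong (- (β ^ q-1) *_) linCoeff-* ⟩
      - (β ^ q-1) * (linCoeff es * linCoeff G)
        ≡⟨ solve 3 (λ B E G → (:- B) :* (E :* G) := E :* ((:- B) :* G)) refl (β ^ q-1) (linCoeff es) (linCoeff G) ⟩
      linCoeff es * (- (β ^ q-1) * linCoeff G)
        ≡⟨ cong (λ u → linCoeff es * (- (u ^ q-1) * linCoeff G)) (sym L[G]t′≡β) ⟩
      linCoeff es * (- (L[ G ] t′ ^ q-1) * linCoeff G)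
        ≡⟨ cong (linCoeff es *_) (sym (linCoeff-∷ t′ G (t′∉ , G-independent))) ⟩
      linCoeff es * linCoeff (t′ ∷ G) ∎

  composition : ∀ ts es → Independent (ts ++ es) → Composition ts es
  composition [] es _ = record
    { L-∘               = λ x → sym (L-[] (L[ es ] x))
    ; linCoeff-*        = sym (≡-trans (cong (linCoeff es *_) linCoeff-[]) (*-identityʳ _))
    ; spanSum-++        = sym (≡-trans (cong (λ t → spanSum es + invPow (linCoeff es ⁻¹) * t) spanSum-[])
                                       (solve 2 (λ S k → S :+ k :* 𝟘 := S) refl (spanSum es) _))
    ; image-independent = tt
    }
  composition (t ∷ ts) es ind@(_ , ind′) = composition-∷ t ts es ind (composition ts es ind′)

  span-++⁻ : ∀ ts es {x} → x ∈ span (ts ++ es) → ∃ λ u → ∃ λ w → u ∈ span ts × w ∈ span es × x ≡ u + w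
  span-++⁻ []       es {x} x∈ = 0# , x , here refl , x∈ , sym (+-identityˡ x)
  span-++⁻ (t ∷ ts) es x∈ with ∈-span-∷⁻ t (ts ++ es) x∈
  ... | c , v , cᵠ≡c , v∈ , refl with span-++⁻ ts es v∈
  ...   | u , w , u∈ , w∈ , refl = c * t + u , w , ∈-span-∷⁺ t ts cᵠ≡c u∈ , w∈ , sym (+-assoc _ _ _)

  span-++⁺ : ∀ ts es {u w} → u ∈ span ts → w ∈ span es → u + w ∈ span (ts ++ es)
  span-++⁺ []       es {u} {w} (here refl) w∈ = subst (_∈ span es) (sym (+-identityˡ w)) w∈
  span-++⁺ (t ∷ ts) es u∈ w∈ with ∈-span-∷⁻ t ts u∈
  ... | c , v , cᵠ≡c , v∈ , refl =
    subst (_∈ span (t ∷ ts ++ es)) (sym (+-assoc _ _ _)) (∈-span-∷⁺ t (ts ++ es) cᵠ≡c (span-++⁺ ts es v∈ w∈))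

  L-span⁺ : ∀ es ts {u} → u ∈ span ts → L[ es ] u ∈ span (map L[ es ] ts)
  L-span⁺ es []       (here refl) = here (L≡0⁺ es (0∈span es))
  L-span⁺ es (t ∷ ts) u∈ with ∈-span-∷⁻ t ts u∈
  ... | c , v , cᵠ≡c , v∈ , refl =
    subst (_∈ span (map L[ es ] (t ∷ ts))) (sym (≡-trans (L-+ es (c * t) v) (cong (_+ L[ es ] v) (L-* es cᵠ≡c t))))
      (∈-span-∷⁺ (L[ es ] t) (map L[ es ] ts) cᵠ≡c (L-span⁺ es ts v∈))

  L-span⁻ : ∀ es ts {y} → y ∈ span (map L[ es ] ts) → ∃ λ u → u ∈ span ts × y ≡ L[ es ] u
  L-span⁻ es []       (here refl) = 0# , here refl , sym (L≡0⁺ es (0∈span es))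
  L-span⁻ es (t ∷ ts) y∈ with ∈-span-∷⁻ (L[ es ] t) (map L[ es ] ts) y∈
  ... | c , v , cᵠ≡c , v∈ , refl with L-span⁻ es ts v∈
  ...   | u , u∈ , refl = c * t + u , ∈-span-∷⁺ t ts cᵠ≡c u∈ ,
                          sym (≡-trans (L-+ es (c * t) u) (cong (_+ L[ es ] u) (L-* es cᵠ≡c t)))

  span⊆ : (E : Subspace) → ∀ bs → (∀ {b} → b ∈ bs → mem E b) → ∀ {x} → x ∈ span bs → mem E x
  span⊆ E []       _    (here refl) = zero∈ E
  span⊆ E (a ∷ bs) bs⊆E x∈ with ∈-span-∷⁻ a bs x∈
  ... | c , v , cᵠ≡c , v∈ , refl = +-closed E (·-closed E cᵠ≡c (bs⊆E (here refl))) (span⊆ E bs (bs⊆E ∘ there) v∈)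

  length-independent≤n : ∀ bs → Independent bs → length bs ≤ n
  length-independent≤n bs ind = qᵃ≤qᵇ⇒a≤b (subst₂ _≤_ (length-span bs) card≡qⁿ
    (unique-⊆⇒length≤ _≟_ (span-unique bs ind) unique (λ _ → complete _)))

  _∈span?_ : ∀ x bs → Dec (x ∈ span bs)
  x ∈span? bs = ∈-dec _≟_ x (span bs)

  record Extension (E : Subspace) (bs : List Carrier) : Set where
    field
      ts          : List Carrier
      independent : Independent (ts ++ bs)
      span⊆E      : ∀ {x} → x ∈ span (ts ++ bs) → mem E x
      E⊆span      : ∀ x → mem E x → x ∈ span (ts ++ bs)

  -- The fuel f bounds the number of vectors that can still be added, since independent lists have length ≤ n.
  extend : (E : Subspace) → ∀ f bs → Independent bs → (∀ {x} → x ∈ span bs → mem E x) →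
           suc n ≤ f ℕ.+ length bs → Extension E bs
  extend E f bs ind bs⊆E n<f+len with any? (λ x → mem? E x ×-dec ¬? (x ∈span? bs)) elems
  ... | no none = record { ts = [] ; independent = ind ; span⊆E = bs⊆E ; E⊆span = E⊆span }
    where
    E⊆span : ∀ x → mem E x → x ∈ span bs
    E⊆span x x∈E with x ∈span? bs
    ... | yes x∈ = x∈
    ... | no  x∉ = ⊥-elim (none (Any.map (λ { refl → x∈E , x∉ }) (complete x)))
  ... | yes some with find some | f
  ...   | x , _ , x∈E , x∉ | zero   = ⊥-elim (ℕ.<⇒≱ n<f+len (length-independent≤n bs ind))
  ...   | x , _ , x∈E , x∉ | suc f′ = record
    { ts          = Extension.ts r ++ [ x ]
    ; independent = subst Independent reassoc (Extension.independent r)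
    ; span⊆E      = λ y∈ → Extension.span⊆E r (subst (λ l → _ ∈ span l) (sym reassoc) y∈)
    ; E⊆span      = λ y y∈E → subst (λ l → y ∈ span l) reassoc (Extension.E⊆span r y y∈E)
    }
    where
    r : Extension E (x ∷ bs)
    r = extend E f′ (x ∷ bs) (x∉ , ind)
               (span⊆ E (x ∷ bs) (λ { (here refl) → x∈E ; (there b∈) → bs⊆E (∈-span bs b∈) }))
               (subst (suc n ≤_) (sym (ℕ.+-suc f′ (length bs))) n<f+len)
    reassoc : Extension.ts r ++ x ∷ bs ≡ (Extension.ts r ++ [ x ]) ++ bs
    reassoc = sym (List.++-assoc (Extension.ts r) [ x ] bs)

  subspaceBasis : (E : Subspace) → Extension E []
  subspaceBasis E = extend E (suc n) [] tt (λ { (here refl) → zero∈ E }) (ℕ.≤-reflexive (sym (ℕ.+-identityʳ _)))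

module Duality (K : FiniteField) {p m n : ℕ} (p-prime : Prime p) (1≤m : 1 ≤ m) (2≤n : 2 ≤ n)
               (card≡qⁿ : FiniteField.card K ≡ (p ℕ.^ m) ℕ.^ n) where

  open SubspacePolynomials K p-prime 1≤m (ℕ.≤-trans (s≤s z≤n) 2≤n) card≡qⁿ public
  open ≡-Reasoning

  outside𝔽q-nonempty : ∃ λ a → a ∈ outside𝔽q
  outside𝔽q-nonempty with outside𝔽q in eq
  ... | a ∷ _ = a , here refl
  ... | []    = ⊥-elim (ℕ.<-irrefl q¹≡qⁿ (ℕ.^-monoʳ-< q q≥2 2≤n))
    where
    q¹≡qⁿ : q ℕ.^ 1 ≡ q ℕ.^ n
    q¹≡qⁿ = begin
      q ℕ.^ 1
        ≡⟨ ℕ.^-identityʳ q ⟩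
      q
        ≡⟨ q≡1+q-1 ⟩
      suc q-1
        ≡⟨ cong suc (sym (≡-trans (cong (λ xs → length 𝔽q* ℕ.+ length xs) eq)
                                  (≡-trans (ℕ.+-identityʳ _) length-𝔽q*))) ⟩
      suc (length 𝔽q* ℕ.+ length outside𝔽q)
        ≡⟨ cong suc (sym (length-filter+length-filter∁ InFq? nonzeros)) ⟩
      suc (length nonzeros)
        ≡⟨ sym card≡1+length-nonzeros ⟩
      card
        ≡⟨ card≡qⁿ ⟩
      q ℕ.^ n ∎

  g-* : ∀ {a} x → a ≢ 0# → g (a * x) ≡ invPow a * g x
  g-* {a} x a≢0 = by-cases (x ≟ 0#)
    where
    by-cases : Dec (x ≡ 0#) → g (a * x) ≡ invPow a * g x
    by-cases (yes refl) = ≡-trans (cong g (zeroʳ a)) (≡-trans g-0 (sym (≡-trans (cong (invPow a *_) g-0) (zeroʳ _))))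
    by-cases (no  x≢0)  = ≡-trans (g≡invPow (*-≢0 a≢0 x≢0))
                                  (≡-trans (invPow-* a≢0 x≢0) (cong (invPow a *_) (sym (g≡invPow x≢0))))

  -- Scaling by an a ∉ 𝔽q multiplies the sum by invPow a ≠ 1.
  sum-g≡0 : sumL elems g ≡ 0#
  sum-g≡0 with outside𝔽q-nonempty
  ... | a , a∈ with ∈-filter⁻ (¬? ∘ InFq?) {xs = nonzeros} a∈
  ...   | a∈nonzeros , a∉𝔽q = *-fixed⇒≡0 invPow[a]≢1 (begin
    invPow a * sumL elems g             ≡⟨ sym (sum-distribˡ elems (invPow a) g) ⟩
    sumL elems (λ x → invPow a * g x)   ≡⟨ ∑.fold-ext elems (λ x → sym (g-* x a≢0)) ⟩
    sumL elems (λ x → g (a * x))        ≡⟨ sym (∑.fold-map (a *_) elems g) ⟩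
    sumL (map (a *_) elems) g           ≡⟨ ∑.fold-↭ g (map-*-↭ a≢0 unique (λ _ → complete _) (λ _ → complete _)) ⟩
    sumL elems g                        ∎)
    where
    a≢0 : a ≢ 0#
    a≢0 = ∈nonzeros⁻ a∈nonzeros
    invPow[a]≢1 : invPow a ≢ 1#
    invPow[a]≢1 invPow[a]≡1 = a∉𝔽q (begin
      a ^ q          ≡⟨ x^q≡x*x^q-1 a ⟩
      a * a ^ q-1    ≡⟨ cong (a *_) (x⁻¹≡1⇒x≡1 (^-≢0 q-1 a≢0) invPow[a]≡1) ⟩
      a * 1#         ≡⟨ *-identityʳ a ⟩
      a              ∎)

  spanSum-complete : ∀ bs → Independent bs → (∀ x → x ∈ span bs) → spanSum bs ≡ 0#
  spanSum-complete bs ind all∈ = ≡-trans (sym (∑.fold-↭ g (elems-↭ (span-unique bs ind) all∈))) sum-g≡0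

  spanSum-complement : ∀ ts es → Independent (ts ++ es) → (∀ x → x ∈ span (ts ++ es)) →
                       spanSum es ≡ 0# ⇔ spanSum (map L[ es ] ts) ≡ 0#
  spanSum-complement ts es ind all∈ = mk⇔ to from
    where
    open Composition (composition ts es ind)
    κ = invPow (linCoeff es ⁻¹)
    S = spanSum (map L[ es ] ts)
    Sₑ+κS≡0 : spanSum es + κ * S ≡ 0#
    Sₑ+κS≡0 = ≡-trans (sym spanSum-++) (spanSum-complete (ts ++ es) ind all∈)
    to : spanSum es ≡ 0# → S ≡ 0#
    to Sₑ≡0 with x*y≡0⇒x≡0⊎y≡0 κ S (≡-trans (sym (+-identityˡ _))
                                          (≡-trans (cong (_+ κ * S) (sym Sₑ≡0)) Sₑ+κS≡0))
    ... | inj₁ κ≡0 = ⊥-elim (invPow-≢0 (⁻¹-≢0 (linCoeff-≢0 es)) κ≡0)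
    ... | inj₂ S≡0 = S≡0
    from : S ≡ 0# → spanSum es ≡ 0#
    from S≡0 = begin
      spanSum es                   ≡⟨ solve 2 (λ s t → s := (s :+ t) :- t) refl (spanSum es) (κ * S) ⟩
      (spanSum es + κ * S) - κ * S ≡⟨ cong₂ _-_ Sₑ+κS≡0 (≡-trans (cong (κ *_) S≡0) (zeroʳ κ)) ⟩
      0# - 0#                      ≡⟨ -‿inverseʳ 0# ⟩
      0#                           ∎

  sumInvPowNonzero≡spanSum : {P : Pred Carrier 0ℓ} (P? : Decidable P) → ∀ bs → Independent bs →
                             (∀ {x} → P x → x ∈ span bs) → (∀ {x} → x ∈ span bs → P x) →
                             sumInvPowNonzero P? ≡ spanSum bs
  sumInvPowNonzero≡spanSum P? bs ind P⊆span span⊆P =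
    ≡-trans (drop-zero elems) (∑.fold-↭ g (elemsOf-↭ P? (span-unique bs ind) P⊆span span⊆P))
    where
    drop-zero : ∀ xs → sumL (filter (λ u → P? u ×-dec ¬? (u ≟ 0#)) xs) invPow ≡ sumL (filter P? xs) g
    drop-zero []       = refl
    drop-zero (x ∷ xs) with P? x | x ≟ 0#
    ... | yes _ | yes refl = ≡-trans (drop-zero xs) (sym (≡-trans (cong (_+ sumL (filter P? xs) g) g-0) (+-identityˡ _)))
    ... | yes _ | no  x≢0  = cong₂ _+_ (sym (g≡invPow x≢0)) (drop-zero xs)
    ... | no  _ | _        = drop-zero xs

  ++-independent : (E F : Subspace) → DirectSum E F → ∀ fs es → Independent fs → Independent es →
                   (∀ {x} → x ∈ span fs → mem F x) → (∀ {x} → x ∈ span es → mem E x) → Independent (fs ++ es)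
  ++-independent E F E⊕F []       es _            ind-es _      _      = ind-es
  ++-independent E F E⊕F (f ∷ fs) es (f∉ , ind-fs) ind-es span⊆F span⊆E =
    f∉′ , ++-independent E F E⊕F fs es ind-fs ind-es (span⊆F ∘ span⊆span-∷ f fs) span⊆E
    where
    f∉′ : f ∉ span (fs ++ es)
    f∉′ f∈ with span-++⁻ fs es f∈
    ... | u , w , u∈ , w∈ , f≡u+w = f∉ (subst (_∈ span fs) (sym f≡u) u∈)
      where
      w∈F : mem F w
      w∈F = subst (mem F) (≡-trans (cong (_- u) f≡u+w) (solve 2 (λ u w → (u :+ w) :- u := w) refl u w))
              (+-closed F (span⊆F (∈-span-head f fs))
                 (subst (mem F) (-1*x≈-x u) (·-closed F (InFq-neg InFq-1) (span⊆F (span⊆span-∷ f fs u∈)))))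
      f≡u : f ≡ u
      f≡u = ≡-trans f≡u+w (≡-trans (cong (u +_) (DirectSum.trivial∩ E⊕F w (span⊆E w∈) w∈F)) (+-identityʳ u))

  direct-sum-duality : (E F : Subspace) → DirectSum E F →
                       (sumInvPowNonzero (mem? E) ≢ 0#) ⇔ (sumInvPowNonzero (InImage? E F) ≢ 0#)
  direct-sum-duality E F E⊕F =
    mk⇔ (λ Sₑ≢0 S≡0 → Sₑ≢0 (≡-trans Sₑ≡ (Equivalence.from complement (≡-trans (sym S≡) S≡0))))
        (λ S≢0 Sₑ≡0 → S≢0 (≡-trans S≡ (Equivalence.to complement (≡-trans (sym Sₑ≡) Sₑ≡0))))
    where
    module BE = Extension (subspaceBasis E)
    module BF = Extension (subspaceBasis F)
    es = BE.ts ++ []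
    fs = BF.ts ++ []
    G  = map L[ es ] fs
    independent : Independent (fs ++ es)
    independent = ++-independent E F E⊕F fs es BF.independent BE.independent BF.span⊆E BE.span⊆E
    all∈ : ∀ x → x ∈ span (fs ++ es)
    all∈ x with DirectSum.spanning E⊕F x
    ... | e , f , e∈E , f∈F , refl =
      subst (_∈ span (fs ++ es)) (+-comm f e) (span-++⁺ fs es (BF.E⊆span f f∈F) (BE.E⊆span e e∈E))
    complement : spanSum es ≡ 0# ⇔ spanSum G ≡ 0#
    complement = spanSum-complement fs es independent all∈
    L≡L[es] : ∀ x → L E x ≡ L[ es ] x
    L≡L[es] x = ∏.fold-↭ (λ u → x - u) (elemsOf-↭ (mem? E) (span-unique es BE.independent) (BE.E⊆span _) BE.span⊆E)
    image⊆ : ∀ {v} → InImage E F v → v ∈ span G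
    image⊆ v∈ with find v∈
    ... | f , _ , f∈F , refl = subst (_∈ span G) (sym (L≡L[es] f)) (L-span⁺ es fs (BF.E⊆span f f∈F))
    ⊆image : ∀ {v} → v ∈ span G → InImage E F v
    ⊆image v∈ with L-span⁻ es fs v∈
    ... | u , u∈ , refl = Any.map (λ { refl → BF.span⊆E u∈ , L≡L[es] u }) (complete u)
    Sₑ≡ : sumInvPowNonzero (mem? E) ≡ spanSum es
    Sₑ≡ = sumInvPowNonzero≡spanSum (mem? E) es BE.independent (BE.E⊆span _) BE.span⊆E
    S≡ : sumInvPowNonzero (InImage? E F) ≡ spanSum G
    S≡ = sumInvPowNonzero≡spanSum (InImage? E F) G (Composition.image-independent (composition fs es independent)) image⊆ ⊆image

  lincomb∈span : ∀ {k} (v c : Fin k → Carrier) → (∀ i → InFq (c i)) → lincomb c v ∈ span (tabulate v)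
  lincomb∈span {zero}  v c _    = here refl
  lincomb∈span {suc k} v c c∈𝔽q =
    ∈-span-∷⁺ (v Fin.zero) (tabulate (v ∘ Fin.suc)) (c∈𝔽q Fin.zero)
              (lincomb∈span (v ∘ Fin.suc) (c ∘ Fin.suc) (c∈𝔽q ∘ Fin.suc))

  span⇒lincomb : ∀ {k} (v : Fin k → Carrier) {x} → x ∈ span (tabulate v) →
                 ∃ λ c → (∀ i → InFq (c i)) × x ≡ lincomb c v
  span⇒lincomb {zero}  v (here refl) = (λ ()) , (λ ()) , refl
  span⇒lincomb {suc k} v x∈ with ∈-span-∷⁻ (v Fin.zero) (tabulate (v ∘ Fin.suc)) x∈
  ... | c₀ , w , c₀ᵠ≡c₀ , w∈ , refl with span⇒lincomb (v ∘ Fin.suc) w∈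
  ...   | c , c∈𝔽q , refl = c₀ VF.∷ c , (λ { Fin.zero → c₀ᵠ≡c₀ ; (Fin.suc i) → c∈𝔽q i }) , refl

  LinearlyIndependent : ∀ {k} → (Fin k → Carrier) → Set
  LinearlyIndependent v = ∀ c → (∀ i → InFq (c i)) → lincomb c v ≡ 0# → ∀ i → c i ≡ 0#

  independent-tabulate⁺ : ∀ {k} (v : Fin k → Carrier) → LinearlyIndependent v → Independent (tabulate v)
  independent-tabulate⁺ {zero}  v _     = tt
  independent-tabulate⁺ {suc k} v indep = v₀∉ , independent-tabulate⁺ (v ∘ Fin.suc) indep′
    where
    indep′ : LinearlyIndependent (v ∘ Fin.suc)
    indep′ c c∈𝔽q lincomb≡0 i = indep (0# VF.∷ c) (λ { Fin.zero → InFq-0 ; (Fin.suc j) → c∈𝔽q j })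
      (≡-trans (solve 2 (λ v r → 𝟘 :* v :+ r := r) refl (v Fin.zero) _) lincomb≡0) (Fin.suc i)
    v₀∉ : v Fin.zero ∉ span (tabulate (v ∘ Fin.suc))
    v₀∉ v₀∈ with span⇒lincomb (v ∘ Fin.suc) v₀∈
    ... | c , c∈𝔽q , v₀≡ = -1≢0 (indep (- 1# VF.∷ c) (λ { Fin.zero → InFq-neg InFq-1 ; (Fin.suc j) → c∈𝔽q j })
      (≡-trans (cong₂ _+_ (-1*x≈-x (v Fin.zero)) (sym v₀≡)) (-‿inverseˡ (v Fin.zero))) Fin.zero)

  independent-tabulate⁻ : ∀ {k} (v : Fin k → Carrier) → Independent (tabulate v) → LinearlyIndependent v
  independent-tabulate⁻ {suc k} v (v₀∉ , ind) c c∈𝔽q lincomb≡0 = c≡0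
    where
    rest = lincomb (c ∘ Fin.suc) (v ∘ Fin.suc)
    c₀≡0 : c Fin.zero ≡ 0#
    c₀≡0 = span-∷-coefficient-unique (v Fin.zero) (tabulate (v ∘ Fin.suc)) v₀∉ (c∈𝔽q Fin.zero) InFq-0
             (lincomb∈span (v ∘ Fin.suc) (c ∘ Fin.suc) (c∈𝔽q ∘ Fin.suc)) (0∈span (tabulate (v ∘ Fin.suc)))
             (≡-trans lincomb≡0 (solve 1 (λ v → 𝟘 := 𝟘 :* v :+ 𝟘) refl (v Fin.zero)))
    rest≡0 : rest ≡ 0#
    rest≡0 = begin
      rest                       ≡⟨ solve 2 (λ v r → r := 𝟘 :* v :+ r) refl (v Fin.zero) rest ⟩
      0# * v Fin.zero + rest         ≡⟨ cong (λ t → t * v Fin.zero + rest) (sym c₀≡0) ⟩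
      c Fin.zero * v Fin.zero + rest     ≡⟨ lincomb≡0 ⟩
      0#                         ∎
    c≡0 : ∀ i → c i ≡ 0#
    c≡0 Fin.zero    = c₀≡0
    c≡0 (Fin.suc i) = independent-tabulate⁻ (v ∘ Fin.suc) ind (c ∘ Fin.suc) (c∈𝔽q ∘ Fin.suc) rest≡0 i

  affineSum : ∀ {k} → AffineSubspace k → Carrier
  affineSum A = sumL (elemsOf (AffineSubspace.amem? A)) g

  spanAffine : ∀ {k} (v : Fin k → Carrier) → Independent (tabulate v) → AffineSubspace k
  spanAffine v ind = record
    { amem  = _∈ span (tabulate v)
    ; amem? = _∈span? tabulate v
    ; base  = 0#
    ; basis = v
    ; indep = independent-tabulate⁻ v ind
    ; char  = λ x → mk⇔ (to x) (from x)
    }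
    where
    to : ∀ x → x ∈ span (tabulate v) → ∃ λ c → (∀ i → InFq (c i)) × x ≡ 0# + lincomb c v
    to x x∈ with span⇒lincomb v x∈
    ... | c , c∈𝔽q , x≡ = c , c∈𝔽q , ≡-trans x≡ (sym (+-identityˡ _))
    from : ∀ x → (∃ λ c → (∀ i → InFq (c i)) × x ≡ 0# + lincomb c v) → x ∈ span (tabulate v)
    from x (c , c∈𝔽q , x≡) = subst (_∈ span (tabulate v)) (sym (≡-trans x≡ (+-identityˡ _))) (lincomb∈span v c c∈𝔽q)

  affineSum-spanAffine : ∀ {k} (v : Fin k → Carrier) (ind : Independent (tabulate v)) →
                         affineSum (spanAffine v ind) ≡ spanSum (tabulate v)
  affineSum-spanAffine v ind =
    ∑.fold-↭ g (elemsOf-↭ (_∈span? tabulate v) (span-unique _ ind) (λ x∈ → x∈) (λ x∈ → x∈))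

  cosetSum-∈span : ∀ bs → Independent bs → ∀ {b} → b ∈ span bs → cosetSum bs b ≡ spanSum bs
  cosetSum-∈span bs ind {b} b∈ = ≡-trans (sym (∑.fold-map (b +_) (span bs) g)) (∑.fold-↭ g
    (map-bijection-↭ (b +_) (λ x → x - b)
                     (solve 2 (λ b x → (b :+ x) :- b := x) refl b) (solve 2 (λ b x → b :+ (x :- b) := x) refl b)
                     (span-unique bs ind) (span-+ bs b∈) (λ x∈ → span-sub bs x∈ b∈)))

  affineSum≡cosetSum : ∀ {k} (A : AffineSubspace k) →
                       affineSum A ≡ cosetSum (tabulate (AffineSubspace.basis A)) (AffineSubspace.base A)
  affineSum≡cosetSum A = ≡-trans (∑.fold-↭ g (elemsOf-↭ amem? unique-translates A⊆ ⊆A))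
                                 (∑.fold-map (base +_) (span (tabulate basis)) g)
    where
    open AffineSubspace A
    unique-translates : Unique (map (base +_) (span (tabulate basis)))
    unique-translates = Unique.map⁺ (+-cancelˡ base _ _) (span-unique _ (independent-tabulate⁺ basis indep))
    A⊆ : ∀ {x} → amem x → x ∈ map (base +_) (span (tabulate basis))
    A⊆ {x} x∈A with Equivalence.to (char x) x∈A
    ... | c , c∈𝔽q , refl = ∈-map⁺ (base +_) (lincomb∈span basis c c∈𝔽q)
    ⊆A : ∀ {x} → x ∈ map (base +_) (span (tabulate basis)) → amem x
    ⊆A x∈ with ∈-map⁻ (base +_) x∈
    ... | w , w∈ , refl with span⇒lincomb basis w∈
    ...   | c , c∈𝔽q , refl = Equivalence.from (char _) (c , c∈𝔽q , refl)

  affineSum≡0⇒spanSum≡0 : ∀ {k} (A : AffineSubspace k) → affineSum A ≡ 0# →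
                          spanSum (tabulate (AffineSubspace.basis A)) ≡ 0#
  affineSum≡0⇒spanSum≡0 A A≡0 = by-cases (base ∈span? bs)
    where
    open AffineSubspace A
    bs = tabulate basis
    ind : Independent bs
    ind = independent-tabulate⁺ basis indep
    cosetSum≡0 : cosetSum bs base ≡ 0#
    cosetSum≡0 = ≡-trans (sym (affineSum≡cosetSum A)) A≡0
    by-cases : Dec (base ∈ span bs) → spanSum bs ≡ 0#
    by-cases (yes b∈) = ≡-trans (sym (cosetSum-∈span bs ind b∈)) cosetSum≡0
    by-cases (no  b∉) = ⊥-elim (invPow-≢0 (*-≢0 (L-≢0 bs b∉) (⁻¹-≢0 (linCoeff-≢0 bs)))
                                          (≡-trans (sym (cosetSum≡invPow bs ind base b∉)) cosetSum≡0))

  wholeSpace : Subspace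
  wholeSpace = record
    { mem = λ _ → ⊤ ; mem? = λ _ → yes tt ; zero∈ = tt ; +-closed = λ _ _ → tt ; ·-closed = λ _ _ → tt }

  length-spanning≡n : ∀ bs → Independent bs → (∀ x → x ∈ span bs) → length bs ≡ n
  length-spanning≡n bs ind all∈ = ℕ.≤-antisym (length-independent≤n bs ind) (qᵃ≤qᵇ⇒a≤b (ℕ.≤-reflexive (begin
    q ℕ.^ n              ≡⟨ sym card≡qⁿ ⟩
    length elems         ≡⟨ ↭-length (elems-↭ (span-unique bs ind) all∈) ⟩
    length (span bs)     ≡⟨ length-span bs ⟩
    q ℕ.^ length bs      ∎)))

  -- Extend bs to a basis ts ++ bs of K and take G = L[ bs ](ts).
  spanSum≡0-dual : ∀ bs → Independent bs → spanSum bs ≡ 0# →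
                   ∃ λ G → Independent G × length G ≡ n ℕ.∸ length bs × spanSum G ≡ 0#
  spanSum≡0-dual bs ind S≡0 = map L[ bs ] ts , image-independent , length-G , G≡0
    where
    r : Extension wholeSpace bs
    r = extend wholeSpace (suc n) bs ind (λ _ → tt) (ℕ.m≤m+n (suc n) (length bs))
    open Extension r using (ts; independent; E⊆span)
    open Composition (composition ts bs independent) using (image-independent)
    all∈ : ∀ x → x ∈ span (ts ++ bs)
    all∈ x = E⊆span x tt
    G≡0 : spanSum (map L[ bs ] ts) ≡ 0#
    G≡0 = Equivalence.to (spanSum-complement ts bs independent all∈) S≡0
    length-G : length (map L[ bs ] ts) ≡ n ℕ.∸ length bs
    length-G = begin
      length (map L[ bs ] ts)
        ≡⟨ List.length-map L[ bs ] ts ⟩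
      length ts
        ≡⟨ sym (ℕ.m+n∸n≡m (length ts) (length bs)) ⟩
      length ts ℕ.+ length bs ℕ.∸ length bs
        ≡⟨ cong (ℕ._∸ length bs) (sym (List.length-++ ts)) ⟩
      length (ts ++ bs) ℕ.∸ length bs
        ≡⟨ cong (ℕ._∸ length bs) (length-spanning≡n (ts ++ bs) independent all∈) ⟩
      n ℕ.∸ length bs ∎

  SumFree-dual : ∀ k → SumFree (n ℕ.∸ k) g → SumFree k g
  SumFree-dual k sumFree A A≡0
    with spanSum≡0-dual (tabulate basis) (independent-tabulate⁺ basis indep) (affineSum≡0⇒spanSum≡0 A A≡0)
    where open AffineSubspace A
  ... | G , ind , length-G , G≡0 =
    refute G ind (≡-trans length-G (cong (n ℕ.∸_) (List.length-tabulate (AffineSubspace.basis A)))) G≡0 sumFree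
    where
    refute : ∀ {j} G → Independent G → length G ≡ j → spanSum G ≡ 0# → ¬ SumFree j g
    refute G ind refl G≡0 sumFree = sumFree (spanAffine (lookup G) ind′)
      (≡-trans (affineSum-spanAffine (lookup G) ind′) (≡-trans (cong spanSum (List.tabulate-lookup G)) G≡0))
      where
      ind′ : Independent (tabulate (lookup G))
      ind′ = subst Independent (sym (List.tabulate-lookup G)) ind

  sum-free-duality : ∀ k → k ≤ n → (¬ SumFree k g) ⇔ (¬ SumFree (n ℕ.∸ k) g)
  sum-free-duality k k≤n = mk⇔
    (λ ¬sf sf′ → ¬sf (SumFree-dual k sf′))
    (λ ¬sf′ sf → ¬sf′ (SumFree-dual (n ℕ.∸ k) (subst (λ j → SumFree j g) (sym (ℕ.m∸[m∸n]≡n k≤n)) sf)))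

open import Data.Nat using (_^_; _∸_)

theorem4p10 : (p m n : ℕ) → Prime p → 1 ≤ m → 2 ≤ n →
    (K : FiniteField) → FiniteField.card K ≡ (p ^ m) ^ n →
    let q = p ^ m
        open FiniteField K
        open OverBase q
    in ((E F : Subspace) → DirectSum E F →
          (sumInvPowNonzero (mem? E) ≢ 0#) ⇔ (sumInvPowNonzero (InImage? E F) ≢ 0#))
       × ((k : ℕ) → 1 ≤ k → k ≤ n ∸ 1 →
          (¬ SumFree k g) ⇔ (¬ SumFree (n ∸ k) g))
theorem4p10 p m n p-prime 1≤m 2≤n K card≡qⁿ =
  direct-sum-duality , λ k _ k≤n-1 → sum-free-duality k (ℕ.≤-trans k≤n-1 (ℕ.m∸n≤m n 1))
  where open Duality K p-prime 1≤m 2≤n card≡qⁿ
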